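{- Let $\eta\ge1$ and $\zeta\ge\max(\eta,\alpha)$ be integers and let $q,s\ge0$ be integers. Let $G$ satisfy conditions (i)–(v), and let $\mathcal{T}$ be a 2-cleaned $(\zeta,\eta)$-template array in $G$ with sequence $(Y_i,H_i)$, $1\le i\le n$, that admits a privatization $\Pi$. Let $B_1,\dots,B_n$ be a shadowing of $\mathcal{T}$ of degree at most $s$ relative to $U(\mathcal{T})\setminus\Pi$. Let $1\le i\le n$, and let $\{D_j:j\in J\}$ be a bunch of daisies (with respect to $\mathcal{T}$ and this shadowing), each with root in $H_i$ and with $V(D_j)\cap\Pi=\emptyset$, where $$|J|=2q\zeta\beta\bigl(1+(q+s)(\delta^2+1)+2\delta+\delta\tau\bigr)\tau.$$ Then there exist $u\in H_i\cup B_i$ and $J'\subseteq J$ with $|J'|=q$ such that for each $j\in J'$, $u$ is adjacent to the eye of $D_j$ and nonadjacent to every petal of $D_j$.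
   Context: Fixed parameters: integers $\tau\ge0$, $\alpha\ge1$, $\delta\ge1$, $\beta\ge2$ and a non-decreasing $\theta:\mathbb{N}\to\mathbb{N}$. Graphs are finite and simple; $\chi(X)=\chi(G[X])$. A $(k,\delta)$-broom is obtained from a $k$-edge path with ends $a,b$ by adding $\delta$ leaves adjacent to $b$ ($a$ is the handle); $T(\delta)$ is obtained from $\delta$ disjoint $(1,\delta)$-brooms and $\delta$ disjoint $(2,\delta)$-brooms by identifying their handles; $H$-free means no induced subgraph isomorphic to $H$. $\chi^2(G)=\max_v\chi(N^2[v])$, $N^2[v]$ the vertices at distance $\le2$ from $v$. $X\subseteq V(G)$ is matching-covered if each $x\in X$ has a neighbour $y\notin X$ adjacent to no other vertex of $X$. An $(a,b)$-core is a set of $ab$ vertices partitioned into $b$ stable sets (parts) of size $a$ with all edges between distinct parts. Conditions: (i) $G$ is $T(\delta)$-free; (ii) $\chi^2(G)\le\tau$; (iii) every matching-covered set has chromatic number $\le\tau$; (iv) for all $a\ge1$, if $\chi(G)>\theta(a)$ then $G$ has an $(a,\beta)$-core; (v) $G$ has no $(\alpha,\beta+1)$-core. Templates: let $Y$ be a $(\zeta,\beta)$-core. $v\in V(G)\setminus Y$ is dense to $Y$ if it has at least $\alpha$ neighbours in each part of $Y$. $v$ is $\eta$-mixed on $Y$ if $v$ is not dense to $Y$ and has at least $\eta$ neighbours in some part of $Y$. A $(\zeta,\eta)$-template is $(Y,H)$ with $Y\subseteq H\subseteq V(G)$ and every vertex of $H$ $\eta$-mixed on $Y$. A $(\zeta,\eta)$-template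 sequence is $(Y_i,H_i)$, $1\le i\le n$, of templates with, for $i<j$: $H_i\cap H_j=\emptyset$, no edge between $H_i$ and $Y_j$, no vertex of $H_j$ $\eta$-mixed on $Y_i$. A $(\zeta,\eta)$-template array $\mathcal{T}$ is such a sequence plus $U(\mathcal{T})\subseteq V(G)$ whose vertices lie in no $H_i$, are $\eta$-mixed on no $Y_i$, and have a neighbour in $\bigcup_iH_i$. $H(\mathcal{T})=\bigcup_iH_i$, $Y(\mathcal{T})=\bigcup_iY_i$, $Z(\mathcal{T})=H(\mathcal{T})\setminus Y(\mathcal{T})$, $V(\mathcal{T})=H(\mathcal{T})\cup U(\mathcal{T})$. $\mathcal{T}$ is 1-cleaned if for each $i$ no vertex of $V(\mathcal{T})$ is dense to $Y_i$; 2-cleaned if 1-cleaned, for distinct $i,j$ no vertex of $H_i$ has a neighbour in $H_j$, and each $H_i\setminus Y_i$ is stable. A privatization for a 2-cleaned $\mathcal{T}$ is $\Pi\subseteq U(\mathcal{T})$ that is a union of $\delta\tau$ matching-covered sets, whose vertices each have exactly one neighbour in $Z(\mathcal{T})$ and none in $Y(\mathcal{T})$, and such that every vertex of $Z(\mathcal{T})$ has exactly $\delta\tau$ neighbours in $\Pi$. A shadowing of $\mathcal{T}$ is a sequence $B_1,\dots,B_n$ of pairwise disjoint subsets of $U(\mathcal{T})$ with union $U(\mathcal{T})$ such that every vertex of $B_i$ has a neighbour in $H_i$; it has degree at most $s$ relative to $X\subseteq U(\mathcal{T})$ if every $v\in V(\mathcal{T})$ has a neighbour in $B_i\cap X$ for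 at most $s$ indices $i$. A daisy is an induced subgraph $D$ isomorphic to $K_{1,\delta+1}$ with exactly one vertex $u$ (root) in $H(\mathcal{T})$, say $u\in H_i$, $u$ a leaf of $D$ whose neighbour $v$ in $D$ (eye) is in $U(\mathcal{T})$, and $V(D)\setminus\{u,v\}$ (petals) contained in some $B_j$ with $j\ne i$. A bunch of daisies is a set $\{D_j:j\in J\}$, $J\subseteq\{1,\dots,n\}$, with roots $u_j$, eyes $v_j$, petal sets $P_j$, such that $P_j\subseteq B_j$; there is $i\notin J$ with all $u_j\in H_i$; for distinct $j,j'$ the sets $P_j\cup\{v_j\}$, $P_{j'}\cup\{v_{j'}\}$ are disjoint with no edges between them; and for distinct $j,j'$, $u_j$ has no neighbour in $P_{j'}$. -}

module Defs where

open import Data.Nat using (ℕ; zero; suc; _+_; _*_; _≤_; _<_)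
open import Data.Bool using (Bool; true; false; _∨_; _∧_)
open import Data.Fin using (Fin; _≟_) renaming (_<_ to _<ᶠ_)
open import Data.Fin.Subset using (Subset; _∈_; _∉_; _⊆_; _∩_; _∪_; _─_; ∣_∣; ⁅_⁆)
open import Data.Vec using (lookup; tabulate)
open import Data.Product using (Σ; ∃; _×_; _,_)
open import Data.Sum using (_⊎_)
open import Relation.Nullary using (¬_; does)
open import Relation.Binary.PropositionalEquality using (_≡_; _≢_)
open import Function.Bundles using (_⇔_)

record Graph : Set where
  field
    N      : ℕ
    adj    : Fin N → Fin N → Bool
    adj-sym    : ∀ x y → adj x y ≡ adj y x
    adj-irrefl : ∀ x → adj x x ≡ false

anyFin : ∀ {m} → (Fin m → Bool) → Bool
anyFin {zero}  f = false
anyFin {suc m} f = f Fin.zero ∨ anyFin {m} (λ k → f (Fin.suc k))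

bigU : ∀ {N m} → (Fin m → Subset N) → Subset N
bigU S = tabulate (λ v → anyFin (λ k → lookup (S k) v))

module _ (G : Graph) where
  open Graph G

  Adj : Fin N → Fin N → Set
  Adj x y = adj x y ≡ true

  Nbhd : Fin N → Subset N
  Nbhd v = tabulate (adj v)

  N2 : Fin N → Subset N
  N2 v = tabulate (λ w → does (v ≟ w) ∨ adj v w ∨ anyFin (λ u → adj v u ∧ adj u w))

  ChiLe : Subset N → ℕ → Set
  ChiLe X k = Σ (Fin N → Fin k) λ c →
    ∀ x y → x ∈ X → y ∈ X → Adj x y → c x ≢ c y

  ChiGLe : ℕ → Set
  ChiGLe k = Σ (Fin N → Fin k) λ c → ∀ x y → Adj x y → c x ≢ c y

  Stable : Subset N → Set
  Stable X = ∀ x y → x ∈ X → y ∈ X → ¬ Adj x y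

  MatchingCovered : Subset N → Set
  MatchingCovered X = ∀ x → x ∈ X → Σ (Fin N) λ y → y ∉ X × Adj x y ×
    (∀ x' → x' ∈ X → Adj x' y → x' ≡ x)

  IsCore : (a b : ℕ) → (Fin b → Subset N) → Set
  IsCore a b P =
    (∀ p → ∣ P p ∣ ≡ a) ×
    (∀ p → Stable (P p)) ×
    (∀ p p' → p ≢ p' → ∀ x → x ∈ P p → x ∉ P p') ×
    (∀ p p' → p ≢ p' → ∀ x y → x ∈ P p → y ∈ P p' → Adj x y)

  HasCore : ℕ → ℕ → Set
  HasCore a b = Σ (Fin b → Subset N) (IsCore a b)

  -- T(δ): δ (1,δ)-brooms and δ (2,δ)-brooms with handles identified.
  data TV (d : ℕ) : Set where
    hd : TV d
    c1 : Fin d → TV d           -- end b of the i-th (1,δ)-broom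
    l1 : Fin d → Fin d → TV d
    m2 : Fin d → TV d           -- inner path vertex of the i-th (2,δ)-broom
    c2 : Fin d → TV d           -- end b of the i-th (2,δ)-broom
    l2 : Fin d → Fin d → TV d

  data TE' {d : ℕ} : TV d → TV d → Set where
    e-hc1 : ∀ i → TE' hd (c1 i)
    e-c1l : ∀ i k → TE' (c1 i) (l1 i k)
    e-hm2 : ∀ i → TE' hd (m2 i)
    e-mc2 : ∀ i → TE' (m2 i) (c2 i)
    e-c2l : ∀ i k → TE' (c2 i) (l2 i k)

  TE : ∀ {d} → TV d → TV d → Set
  TE x y = TE' x y ⊎ TE' y x

  HasInducedT : ℕ → Set
  HasInducedT d = Σ (TV d → Fin N) λ f →
    (∀ x y → f x ≡ f y → x ≡ y) × (∀ x y → TE x y ⇔ Adj (f x) (f y))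

  Conditions : (τ α δ β : ℕ) → (ℕ → ℕ) → Set
  Conditions τ α δ β θ =
    ¬ HasInducedT δ ×
    (∀ v → ChiLe (N2 v) τ) ×
    (∀ X → MatchingCovered X → ChiLe X τ) ×
    (∀ a → 1 ≤ a → ¬ ChiGLe (θ a) → HasCore a β) ×
    ¬ HasCore α (suc β)

  module _ (α β : ℕ) where
    coreSet : (Fin β → Subset N) → Subset N
    coreSet P = bigU P

    Dense : (Fin β → Subset N) → Fin N → Set
    Dense P v = v ∉ coreSet P × (∀ p → α ≤ ∣ P p ∩ Nbhd v ∣)

    Mixed : ℕ → (Fin β → Subset N) → Fin N → Set
    Mixed η P v = ¬ Dense P v × Σ (Fin β) λ p → η ≤ ∣ P p ∩ Nbhd v ∣

    IsTemplate : (ζ η : ℕ) → (Fin β → Subset N) → Subset N → Set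
    IsTemplate ζ η P H = IsCore ζ β P × coreSet P ⊆ H × (∀ v → v ∈ H → Mixed η P v)

    module _ {n : ℕ} (P : Fin n → Fin β → Subset N) (H : Fin n → Subset N) (U : Subset N) where
      Yi : Fin n → Subset N
      Yi i = coreSet (P i)

      HT YT ZT VT : Subset N
      HT = bigU H
      YT = bigU Yi
      ZT = HT ─ YT
      VT = HT ∪ U

      IsTemplateSeq : (ζ η : ℕ) → Set
      IsTemplateSeq ζ η =
        (∀ i → IsTemplate ζ η (P i) (H i)) ×
        (∀ i j → i <ᶠ j →
           (∀ v → v ∈ H i → v ∉ H j) ×
           (∀ x y → x ∈ H i → y ∈ Yi j → ¬ Adj x y) ×
           (∀ v → v ∈ H j → ¬ Mixed η (P i) v))

      IsTemplateArray : (ζ η : ℕ) → Set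
      IsTemplateArray ζ η = IsTemplateSeq ζ η ×
        (∀ v → v ∈ U →
           (∀ i → v ∉ H i) × (∀ i → ¬ Mixed η (P i) v) ×
           Σ (Fin N) λ w → w ∈ HT × Adj v w)

      OneCleaned : Set
      OneCleaned = ∀ i v → v ∈ VT → ¬ Dense (P i) v

      TwoCleaned : Set
      TwoCleaned = OneCleaned ×
        (∀ i j → i ≢ j → ∀ x y → x ∈ H i → y ∈ H j → ¬ Adj x y) ×
        (∀ i → Stable (H i ─ Yi i))

      IsPrivatization : (δ τ : ℕ) → Subset N → Set
      IsPrivatization δ τ Π =
        Π ⊆ U ×
        (Σ (Fin (δ * τ) → Subset N) λ M →
           (∀ k → MatchingCovered (M k)) × (∀ v → v ∈ Π ⇔ v ∈ bigU M)) ×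
        (∀ v → v ∈ Π → ∣ ZT ∩ Nbhd v ∣ ≡ 1 × (∀ y → y ∈ YT → ¬ Adj v y)) ×
        (∀ z → z ∈ ZT → ∣ Π ∩ Nbhd z ∣ ≡ δ * τ)

      IsShadowing : (Fin n → Subset N) → Set
      IsShadowing B =
        (∀ i j → i ≢ j → ∀ v → v ∈ B i → v ∉ B j) ×
        (∀ v → v ∈ U ⇔ v ∈ bigU B) ×
        (∀ i v → v ∈ B i → Σ (Fin N) λ w → w ∈ H i × Adj v w)

      ShadowDegreeLe : (Fin n → Subset N) → Subset N → ℕ → Set
      ShadowDegreeLe B X s = ∀ v → v ∈ VT →
        ∣ tabulate {n} (λ i → anyFin (λ w → lookup (B i) w ∧ lookup X w ∧ adj v w)) ∣ ≤ s

      -- a daisy with root u ∈ H_i, eye e, petals Q ⊆ B_j (j ≠ i)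
      IsDaisy : (δ : ℕ) → (B : Fin n → Subset N) → (i j : Fin n) → Fin N → Fin N → Subset N → Set
      IsDaisy δ B i j u e Q =
        u ∈ H i × e ∈ U × Q ⊆ B j × j ≢ i ×
        ∣ Q ∣ ≡ δ × u ∉ Q × e ∉ Q × u ≢ e ×
        -- induced K_{1,δ+1} with centre e, leaves u and the petals
        Adj u e × (∀ p → p ∈ Q → Adj e p) × (∀ p → p ∈ Q → ¬ Adj u p) ×
        (∀ p p' → p ∈ Q → p' ∈ Q → ¬ Adj p p') ×
        -- exactly one vertex (u) in H(T)
        e ∉ HT × (∀ p → p ∈ Q → p ∉ HT)

      IsBunch : (δ : ℕ) → (B : Fin n → Subset N) → (i : Fin n) → (J : Subset n) →
                (root eye : Fin n → Fin N) → (pet : Fin n → Subset N) → Set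
      IsBunch δ B i J root eye pet =
        i ∉ J ×
        (∀ j → j ∈ J → IsDaisy δ B i j (root j) (eye j) (pet j)) ×
        (∀ j j' → j ∈ J → j' ∈ J → j ≢ j' →
           (∀ x → x ∈ (pet j ∪ ⁅ eye j ⁆) → x ∉ (pet j' ∪ ⁅ eye j' ⁆)) ×
           (∀ x y → x ∈ (pet j ∪ ⁅ eye j ⁆) → y ∈ (pet j' ∪ ⁅ eye j' ⁆) → ¬ Adj x y) ×
           (∀ p → p ∈ pet j' → ¬ Adj (root j) p))

module Submission where

-- Suppose no vertex of H_i ∪ B_i is good for q daisies of the bunch, i.e. adjacent to the eye and
-- to no petal of each. Then a vertex of H_i ∪ B_i sees the eye or a petal of at most q + s daisies:
-- fewer than q good ones, and at most s through petals, which lie in the sets B_j outside Π. A root is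
-- good for its own daisy, so at most |Y_i| q daisies are rooted in Y_i; every other root lies in
-- Z = H_i ∖ Y_i and, being mixed on Y_i, has a neighbour there, so some y ∈ Y_i is adjacent to many
-- of them. Greedily choose τδ of these roots as centres, keeping many daisies that neither y nor a
-- centre sees. A colouring of N²[y] with τ colours gives δ centres each having δ private
-- Π-neighbours of one common colour; these leaves lie in B_i and are pairwise nonadjacent. Among
-- the daisies no leaf sees, pick δ whose roots see no other eye, possible since each root sees fewer
-- than q eyes. Then y, the centres with their leaves, and the chosen root-eye-petal paths form an
-- induced T(δ), contradicting condition (i); the size of J pays for everything discarded.

open import Defs
open import Data.Nat using (ℕ; suc; _+_; _*_; _≤_)
open import Data.Fin using (Fin)
open import Data.Fin.Subset using (Subset; _∈_; _∉_; _⊆_; _─_; ∣_∣)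
open import Data.Product using (Σ; _×_)
open import Data.Sum using (_⊎_)
open import Relation.Nullary using (¬_)
open import Relation.Binary.PropositionalEquality using (_≡_)

open import Level using (0ℓ)
open import Data.Nat using (zero; _<_; _≤?_; _<?_; z≤n; s≤s; pred; >-nonZero)
open import Data.Nat.Properties
open import Algebra.Properties.CommutativeSemigroup +-commutativeSemigroup using (interchange)
open import Data.Nat.ListAction using (sum)
open import Data.Nat.Tactic.RingSolver using (solve-∀)
open import Data.Bool using (Bool; true; false; _∨_; _∧_)
open import Data.Bool.Properties using (∨-zeroʳ)
import Data.Fin as Fin
import Data.Fin.Properties as Finₚ
open import Data.Fin.Subset using (_∩_; _∪_; ⁅_⁆; ⊥; Nonempty)
open import Data.Fin.Subset.Properties using (drop-there; ∉⊥; x∈p∪q⁻; x∈p∪q⁺; x∈⁅x⁆; x∈⁅y⁆⇒x≡y; x∈p∩q⁺; x∈p∩q⁻; x∈p∧x∉q⇒x∈p─q; p─q⊆p; _∈?_)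
open import Data.Vec using (_∷_; []; lookup; tabulate)
import Data.Vec as Vec
open import Data.Vec.Properties using (lookup∘tabulate; []=⇒lookup; lookup⇒[]=)
open import Data.List using (List; []; _∷_; length; filter; map; concat; take; allFin)
import Data.List as List
open import Data.List.Properties using (filter-notAll; filter-all; map-cong; length-++; length-map; length-take; length-tabulate; take++drop≡id)
open import Data.List.Membership.Propositional using (find) renaming (_∈_ to _∈ˡ_)
open import Data.List.Membership.Propositional.Properties using (∈-filter⁺; ∈-filter⁻; ∈-map⁺; ∈-map⁻; ∈-lookup; ∈-++⁺ˡ; ∈-allFin; ∈-concat⁺′; ∈-concat⁻′; ∈-tabulate⁺; ∈-tabulate⁻)
open import Data.List.Relation.Unary.Any using (here; there)
import Data.List.Relation.Unary.Any as Any
import Data.List.Relation.Unary.All as All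
open import Data.List.Relation.Unary.Unique.Propositional using (Unique; []; _∷_)
import Data.List.Relation.Unary.Unique.Propositional.Properties as Unique
open import Data.List.Relation.Binary.Subset.Propositional using () renaming (_⊆_ to _⊆ˡ_)
open import Data.List.Relation.Binary.Sublist.Propositional.Properties using (filter⁺; filter-⊆; length-mono-≤)
open import Data.Product using (∃; _,_; proj₁; proj₂)
open import Data.Sum using (inj₁; inj₂; [_,_]′)
open import Function using (_∘_; id)
open import Function.Bundles using (Equivalence; mk⇔)
open import Relation.Nullary using (¬?; Dec; yes; no; does; contradiction; _×-dec_; _⊎-dec_)
open import Relation.Nullary.Decidable using (toSum)
open import Relation.Unary using (Pred; Decidable)
open import Relation.Unary.Properties using (∁?; _∪?_)
open import Relation.Binary using (Rel)
import Relation.Binary.Definitions as B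
open import Relation.Binary.Definitions using (tri<; tri≈; tri>)
open import Relation.Binary.PropositionalEquality using (_≢_; refl; sym; trans; cong; cong₂; subst; module ≡-Reasoning)

-- Counting with lists

module _ {A : Set} where

  length-filter-split : {P : Pred A 0ℓ} (P? : Decidable P) (xs : List A) →
    length xs ≡ length (filter P? xs) + length (filter (∁? P?) xs)
  length-filter-split P? [] = refl
  length-filter-split P? (x ∷ xs) with does (P? x)
  ... | true  = cong suc (length-filter-split P? xs)
  ... | false = trans (cong suc (length-filter-split P? xs)) (sym (+-suc _ _))

  length-filter-filter : {P Q : Pred A 0ℓ} (P? : Decidable P) (Q? : Decidable Q) (xs : List A) →
    length (filter P? (filter Q? xs)) ≤ length (filter P? xs)
  length-filter-filter P? Q? xs = length-mono-≤ (filter⁺ P? P? (λ { refl p → p }) (filter-⊆ Q? xs))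

  length-filter-mono : {P Q : Pred A 0ℓ} (P? : Decidable P) (Q? : Decidable Q) →
    (∀ {x} → P x → Q x) → (xs : List A) → length (filter P? xs) ≤ length (filter Q? xs)
  length-filter-mono P? Q? P⇒Q [] = z≤n
  length-filter-mono P? Q? P⇒Q (x ∷ xs) with P? x | Q? x
  ... | yes _  | yes _  = s≤s (length-filter-mono P? Q? P⇒Q xs)
  ... | yes px | no ¬qx = contradiction (P⇒Q px) ¬qx
  ... | no _   | yes _  = m≤n⇒m≤1+n (length-filter-mono P? Q? P⇒Q xs)
  ... | no _   | no _   = length-filter-mono P? Q? P⇒Q xs

  length-filter-∪ : {P Q : Pred A 0ℓ} (P? : Decidable P) (Q? : Decidable Q) (xs : List A) →
    length (filter (P? ∪? Q?) xs) ≤ length (filter P? xs) + length (filter Q? xs)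
  length-filter-∪ P? Q? [] = z≤n
  length-filter-∪ P? Q? (x ∷ xs) with ih ← length-filter-∪ P? Q? xs | does (P? x) | does (Q? x)
  ... | true  | true  = s≤s (≤-trans ih (+-monoʳ-≤ _ (n≤1+n _)))
  ... | true  | false = s≤s ih
  ... | false | true  = ≤-trans (s≤s ih) (≤-reflexive (sym (+-suc _ _)))
  ... | false | false = ih

  sum-map-+ : (f g : A → ℕ) (xs : List A) →
    sum (map (λ x → f x + g x) xs) ≡ sum (map f xs) + sum (map g xs)
  sum-map-+ f g [] = refl
  sum-map-+ f g (x ∷ xs) rewrite sum-map-+ f g xs = interchange (f x) (g x) (sum (map f xs)) (sum (map g xs))

  sum-map-≥ : (f : A → ℕ) (c : ℕ) (xs : List A) → (∀ {x} → x ∈ˡ xs → c ≤ f x) → length xs * c ≤ sum (map f xs)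
  sum-map-≥ f c [] _ = z≤n
  sum-map-≥ f c (x ∷ xs) c≤f = +-mono-≤ (c≤f (here refl)) (sum-map-≥ f c xs (c≤f ∘ there))

  sum-map-≤ : (f : A → ℕ) (c : ℕ) (xs : List A) → (∀ {x} → x ∈ˡ xs → f x ≤ c) → sum (map f xs) ≤ length xs * c
  sum-map-≤ f c [] _ = z≤n
  sum-map-≤ f c (x ∷ xs) f≤c = +-mono-≤ (f≤c (here refl)) (sum-map-≤ f c xs (f≤c ∘ there))

  length-concat-tabulate : ∀ {m} (f : Fin m → List A) (c : ℕ) → (∀ a → length (f a) ≡ c) →
    length (List.concat (List.tabulate f)) ≡ m * c
  length-concat-tabulate {zero} f c _ = refl
  length-concat-tabulate {suc m} f c len≡c = trans (length-++ (f Fin.zero))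
    (cong₂ _+_ (len≡c Fin.zero) (length-concat-tabulate (f ∘ Fin.suc) c (len≡c ∘ Fin.suc)))

  lookup-injective : {xs : List A} → Unique xs → ∀ i j → List.lookup xs i ≡ List.lookup xs j → i ≡ j
  lookup-injective {x ∷ xs} _ Fin.zero Fin.zero _ = refl
  lookup-injective {x ∷ xs} u Fin.zero (Fin.suc j) x≡ =
    contradiction (subst (_∈ˡ xs) (sym x≡) (∈-lookup j)) (Unique.Unique[x∷xs]⇒x∉xs u)
  lookup-injective {x ∷ xs} u (Fin.suc i) Fin.zero ≡x =
    contradiction (subst (_∈ˡ xs) ≡x (∈-lookup i)) (Unique.Unique[x∷xs]⇒x∉xs u)
  lookup-injective {x ∷ xs} (_ ∷ uxs) (Fin.suc i) (Fin.suc j) eq = cong Fin.suc (lookup-injective uxs i j eq)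

  enumerate : (xs : List A) {k : ℕ} → k ≤ length xs → Fin k → A
  enumerate xs k≤ i = List.lookup xs (Fin.inject≤ i k≤)

  enumerate-∈ : (xs : List A) {k : ℕ} (k≤ : k ≤ length xs) (i : Fin k) → enumerate xs k≤ i ∈ˡ xs
  enumerate-∈ xs k≤ i = ∈-lookup (Fin.inject≤ i k≤)

  enumerate-injective : {xs : List A} {k : ℕ} (k≤ : k ≤ length xs) → Unique xs →
    ∀ i j → enumerate xs k≤ i ≡ enumerate xs k≤ j → i ≡ j
  enumerate-injective k≤ uxs i j eq = Finₚ.inject≤-injective k≤ k≤ i j (lookup-injective uxs _ _ eq)

module _ {A : Set} where

  pigeonhole : {X : Set} {R : X → A → Set} (R? : ∀ x b → Dec (R x b)) (t : ℕ) (bs : List A) (xs : List X) →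
    (∀ {x} → x ∈ˡ xs → ∃ λ b → b ∈ˡ bs × R x b) → length bs * t < length xs →
    ∃ λ b → b ∈ˡ bs × t < length (filter (λ x → R? x b) xs)
  pigeonhole R? t [] (x ∷ xs) related _ with () ← proj₁ (proj₂ (related (here refl)))
  pigeonhole {R = R} R? t (b ∷ bs) xs related lt with t <? length (filter (λ x → R? x b) xs)
  ... | yes t<fibre = b , here refl , t<fibre
  ... | no t≮fibre =
    let b′ , b′∈bs , t<fibre′ = pigeonhole R? t bs rest related′ lt′
    in b′ , there b′∈bs , <-≤-trans t<fibre′ (length-filter-filter (λ x → R? x b′) _ xs)
    where
    rest = filter (λ x → ¬? (R? x b)) xs
    related′ : ∀ {x} → x ∈ˡ rest → ∃ λ b′ → b′ ∈ˡ bs × R x b′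
    related′ x∈rest with ∈-filter⁻ (λ x → ¬? (R? x b)) {xs = xs} x∈rest
    ... | x∈xs , ¬Rxb with related x∈xs
    ... | b′ , here refl , Rxb = contradiction Rxb ¬Rxb
    ... | b′ , there b′∈bs , Rxb′ = b′ , b′∈bs , Rxb′
    lt′ : length bs * t < length rest
    lt′ = +-cancelˡ-< t _ _ (<-≤-trans lt (begin
      length xs                                                   ≡⟨ length-filter-split (λ x → R? x b) xs ⟩
      length (filter (λ x → R? x b) xs) + length rest             ≤⟨ +-monoˡ-≤ _ (≮⇒≥ t≮fibre) ⟩
      t + length rest                                             ∎))
      where open ≤-Reasoning

module _ {A : Set} {R : Rel A 0ℓ} (R? : B.Decidable R) where

  private
    length-filter-∷ : (y : A) (x : A) (xs : List A) →
      length (filter (R? y) (x ∷ xs)) ≡ length (filter (R? y) (x ∷ [])) + length (filter (R? y) xs)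
    length-filter-∷ y x xs with does (R? y x)
    ... | true  = refl
    ... | false = refl

    sum-indicator : (x : A) (ys : List A) →
      sum (map (λ y → length (filter (R? y) (x ∷ []))) ys) ≡ length (filter (λ y → R? y x) ys)
    sum-indicator x [] = refl
    sum-indicator x (y ∷ ys) with does (R? y x)
    ... | true  = cong suc (sum-indicator x ys)
    ... | false = sum-indicator x ys

  double-counting : (xs ys : List A) →
    sum (map (λ x → length (filter (λ y → R? y x) ys)) xs) ≡ sum (map (λ y → length (filter (R? y) xs)) ys)
  double-counting [] ys = sym (sum-map-zero ys)
    where
    sum-map-zero : (ys : List A) → sum (map (λ _ → 0) ys) ≡ 0
    sum-map-zero [] = refl
    sum-map-zero (_ ∷ ys) = sum-map-zero ys
  double-counting (x ∷ xs) ys = begin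
    length (filter (λ y → R? y x) ys) + sum (map (λ x → length (filter (λ y → R? y x) ys)) xs)
      ≡⟨ cong₂ _+_ (sym (sum-indicator x ys)) (double-counting xs ys) ⟩
    sum (map (λ y → length (filter (R? y) (x ∷ []))) ys) + sum (map (λ y → length (filter (R? y) xs)) ys)
      ≡⟨ sym (sum-map-+ _ _ ys) ⟩
    sum (map (λ y → length (filter (R? y) (x ∷ [])) + length (filter (R? y) xs)) ys)
      ≡⟨ cong sum (map-cong (λ y → sym (length-filter-∷ y x xs)) ys) ⟩
    sum (map (λ y → length (filter (R? y) (x ∷ xs))) ys) ∎
    where open ≡-Reasoning

module WithDecEq {A : Set} (_≟_ : B.DecidableEquality A) where

  Unique-length-≤ : {xs ys : List A} → Unique xs → xs ⊆ˡ ys → length xs ≤ length ys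
  Unique-length-≤ {[]} _ _ = z≤n
  Unique-length-≤ {x ∷ xs} {ys} (x∉xs ∷ uxs) xs⊆ys = ≤-<-trans
    (Unique-length-≤ {ys = filter (λ y → ¬? (x ≟ y)) ys} uxs
      (λ z∈xs → ∈-filter⁺ _ (xs⊆ys (there z∈xs)) (x≢z z∈xs)))
    (filter-notAll _ ys (Any.map contradiction (xs⊆ys (here refl))))
    where
    x≢z : ∀ {z} → z ∈ˡ xs → x ≢ z
    x≢z z∈xs refl = Unique.Unique[x∷xs]⇒x∉xs (x∉xs ∷ uxs) z∈xs

  module _ {R : Rel A 0ℓ} (R? : B.Decidable R) (d : ℕ) where

    OutDegree≤ : List A → Set
    OutDegree≤ xs = ∀ {x} → x ∈ˡ xs → length (filter (R? x) xs) ≤ d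

    low-in-degree : (xs : List A) → 0 < length xs → OutDegree≤ xs →
      ∃ λ x → x ∈ˡ xs × length (filter (λ y → R? y x) xs) ≤ d
    low-in-degree xs 0<len outdeg with Any.any? (λ x → length (filter (λ y → R? y x) xs) ≤? d) xs
    ... | yes some = find some
    ... | no none = contradiction total-in≤total-out (<⇒≱ (*-monoʳ-< (length xs) (n<1+n d)))
      where
      instance _ = >-nonZero 0<len
      in-degree> : ∀ {x} → x ∈ˡ xs → suc d ≤ length (filter (λ y → R? y x) xs)
      in-degree> x∈xs = ≰⇒> (λ x-low → none (Any.map (λ { refl → x-low }) x∈xs))
      total-in≤total-out : length xs * suc d ≤ length xs * d
      total-in≤total-out = begin
        length xs * suc d                                         ≤⟨ sum-map-≥ _ (suc d) xs in-degree> ⟩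
        sum (map (λ x → length (filter (λ y → R? y x) xs)) xs)    ≡⟨ double-counting R? xs xs ⟩
        sum (map (λ y → length (filter (R? y) xs)) xs)            ≤⟨ sum-map-≤ _ d xs outdeg ⟩
        length xs * d                                             ∎
        where open ≤-Reasoning

    Clash : A → A → Set
    Clash x y = x ≡ y ⊎ R x y ⊎ R y x

    clash? : ∀ x → Decidable (Clash x)
    clash? x y = (x ≟ y) ⊎-dec (R? x y ⊎-dec R? y x)

    clashes-≤ : ∀ {x xs} → Unique xs → OutDegree≤ xs → x ∈ˡ xs → length (filter (λ y → R? y x) xs) ≤ d →
      length (filter (clash? x) xs) ≤ 1 + 2 * d
    clashes-≤ {x} {xs} uxs outdeg x∈xs in-degree = begin
      length (filter (clash? x) xs)                                        ≤⟨ length-filter-∪ (x ≟_) _ xs ⟩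
      length (filter (x ≟_) xs) + length (filter (λ y → R? x y ⊎-dec R? y x) xs)
                                                                            ≤⟨ +-mono-≤ copies-of-x (length-filter-∪ (R? x) (λ y → R? y x) xs) ⟩
      1 + (length (filter (R? x) xs) + length (filter (λ y → R? y x) xs))  ≤⟨ +-monoʳ-≤ 1 (+-mono-≤ (outdeg x∈xs) in-degree) ⟩
      1 + (d + d)                                                          ≡⟨ cong (λ e → 1 + (d + e)) (+-identityʳ d) ⟨
      1 + 2 * d                                                            ∎
      where
      open ≤-Reasoning
      copies-of-x : length (filter (x ≟_) xs) ≤ 1
      copies-of-x = Unique-length-≤ {ys = x ∷ []} (Unique.filter⁺ (x ≟_) uxs)
        (λ y∈ → here (sym (proj₂ (∈-filter⁻ (x ≟_) {xs = xs} y∈))))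

    record IndependentSubset (k : ℕ) (xs : List A) : Set where
      field
        members : List A
        length-members : length members ≡ k
        members-unique : Unique members
        members⊆ : members ⊆ˡ xs
        independent : ∀ {x y} → x ∈ˡ members → y ∈ˡ members → x ≢ y → ¬ R x y

    independent-subset : (k : ℕ) (xs : List A) → Unique xs → OutDegree≤ xs → (1 + 2 * d) * k ≤ length xs →
      IndependentSubset k xs
    independent-subset zero xs _ _ _ = record
      { members = [] ; length-members = refl ; members-unique = [] ; members⊆ = λ () ; independent = λ () }
    independent-subset (suc k) xs uxs outdeg len≥ = record
      { members = x ∷ members
      ; length-members = cong suc length-members
      ; members-unique = All.tabulate (λ y∈ x≡y → no-clash y∈ (inj₁ x≡y)) ∷ members-unique
      ; members⊆ = λ { (here refl) → x∈xs ; (there y∈) → rest⊆xs (members⊆ y∈) }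
      ; independent = independent′
      }
      where
      x-low = low-in-degree xs (<-≤-trans (s≤s z≤n) len≥) outdeg
      x = proj₁ x-low
      x∈xs = proj₁ (proj₂ x-low)
      rest = filter (∁? (clash? x)) xs
      rest⊆xs : rest ⊆ˡ xs
      rest⊆xs = proj₁ ∘ ∈-filter⁻ (∁? (clash? x)) {xs = xs}
      rest≥ : (1 + 2 * d) * k ≤ length rest
      rest≥ = +-cancelˡ-≤ (1 + 2 * d) _ _ (begin
        (1 + 2 * d) + (1 + 2 * d) * k                 ≡⟨ *-suc (1 + 2 * d) k ⟨
        (1 + 2 * d) * suc k                           ≤⟨ len≥ ⟩
        length xs                                     ≡⟨ length-filter-split (clash? x) xs ⟩
        length (filter (clash? x) xs) + length rest   ≤⟨ +-monoˡ-≤ _ (clashes-≤ uxs outdeg x∈xs (proj₂ (proj₂ x-low))) ⟩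
        (1 + 2 * d) + length rest                     ∎)
        where open ≤-Reasoning
      rest-outdeg : OutDegree≤ rest
      rest-outdeg {y} y∈rest = ≤-trans (length-filter-filter (R? y) _ xs) (outdeg (rest⊆xs y∈rest))
      open IndependentSubset (independent-subset k rest (Unique.filter⁺ _ uxs) rest-outdeg rest≥)
      no-clash : ∀ {y} → y ∈ˡ members → ¬ Clash x y
      no-clash y∈ = proj₂ (∈-filter⁻ (∁? (clash? x)) {xs = xs} (members⊆ y∈))
      independent′ : ∀ {y z} → y ∈ˡ x ∷ members → z ∈ˡ x ∷ members → y ≢ z → ¬ R y z
      independent′ (here refl) (here refl) y≢z _ = y≢z refl
      independent′ (here refl) (there z∈) _ Rxz = no-clash z∈ (inj₂ (inj₁ Rxz))
      independent′ (there y∈) (here refl) _ Ryx = no-clash y∈ (inj₂ (inj₂ Ryx))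
      independent′ (there y∈) (there z∈) = independent y∈ z∈

module Blocking {I C : Set} (_≟_ : B.DecidableEquality I) {Blocks : C → I → Set}
                (blocks? : ∀ c → Decidable (Blocks c)) (universe : List I) (b : ℕ) where

  open WithDecEq _≟_

  Sparse : C → Set
  Sparse c = length (filter (blocks? c) universe) ≤ b

  Unblocked : List C → I → Set
  Unblocked cs j = All.All (λ c → ¬ Blocks c j) cs

  unblocked? : (cs : List C) → Decidable (Unblocked cs)
  unblocked? cs j = All.all? (λ c → ¬? (blocks? c j)) cs

  private
    sparse-on : ∀ {c F} → Sparse c → Unique F → F ⊆ˡ universe → length (filter (blocks? c) F) ≤ b
    sparse-on {c} sparse uF F⊆ = ≤-trans
      (Unique-length-≤ (Unique.filter⁺ (blocks? c) uF)
        (λ j∈ → let j∈F , cj = ∈-filter⁻ (blocks? c) j∈ in ∈-filter⁺ (blocks? c) (F⊆ j∈F) cj))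
      sparse

  discard-blocked : ∀ {c F} → Sparse c → Unique F → F ⊆ˡ universe →
    length F ≤ b + length (filter (∁? (blocks? c)) F)
  discard-blocked {c} {F} sparse uF F⊆ = ≤-trans (≤-reflexive (length-filter-split (blocks? c) F))
    (+-monoˡ-≤ _ (sparse-on sparse uF F⊆))

  remove-blocked : (cs : List C) → All.All Sparse cs → ∀ {F} → Unique F → F ⊆ˡ universe →
    length F ≤ length cs * b + length (filter (unblocked? cs) F)
  remove-blocked [] _ {F} _ _ = ≤-reflexive (cong length (sym (filter-all (unblocked? []) {xs = F} (All.tabulate (λ _ → All.[])))))
  remove-blocked (c ∷ cs) (sparse-c All.∷ sparse-cs) {F} uF F⊆ = begin
    length F                                             ≤⟨ discard-blocked sparse-c uF F⊆ ⟩
    b + length F₁                                        ≤⟨ +-monoʳ-≤ b (remove-blocked cs sparse-cs uF₁ (F⊆ ∘ F₁⊆F)) ⟩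
    b + (length cs * b + length (filter (unblocked? cs) F₁)) ≡⟨ +-assoc b _ _ ⟨
    b + length cs * b + length (filter (unblocked? cs) F₁) ≤⟨ +-monoʳ-≤ _ (Unique-length-≤ (Unique.filter⁺ (unblocked? cs) uF₁) shrink) ⟩
    b + length cs * b + length (filter (unblocked? (c ∷ cs)) F) ∎
    where
    open ≤-Reasoning
    F₁ = filter (∁? (blocks? c)) F
    uF₁ = Unique.filter⁺ (∁? (blocks? c)) uF
    F₁⊆F : F₁ ⊆ˡ F
    F₁⊆F = proj₁ ∘ ∈-filter⁻ (∁? (blocks? c))
    shrink : filter (unblocked? cs) F₁ ⊆ˡ filter (unblocked? (c ∷ cs)) F
    shrink j∈ = let j∈F₁ , unblocked-cs = ∈-filter⁻ (unblocked? cs) {xs = F₁} j∈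
                    j∈F , ¬cj = ∈-filter⁻ (∁? (blocks? c)) {xs = F} j∈F₁
                in ∈-filter⁺ (unblocked? (c ∷ cs)) j∈F (¬cj All.∷ unblocked-cs)

  record Blockers (root : I → C) (k r : ℕ) (F : List I) : Set where
    field
      centres : List C
      survivors : List I
      length-centres : length centres ≡ k
      centres-unique : Unique centres
      centres⊆roots : centres ⊆ˡ map root F
      survivors-unique : Unique survivors
      survivors⊆ : survivors ⊆ˡ F
      length-survivors : r ≤ length survivors
      survivors-unblocked : ∀ {j} → j ∈ˡ survivors → Unblocked centres j

  greedy-blockers : (root : I → C) → 0 < b →
    (∀ {j} → j ∈ˡ universe → Sparse (root j)) → (∀ {j} → j ∈ˡ universe → Blocks (root j) j) →
    (k r : ℕ) {F : List I} → Unique F → F ⊆ˡ universe → k * b + r ≤ length F → Blockers root k r F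
  greedy-blockers root 0<b sparse self zero r {F} uF F⊆ r≤ =
    record { centres = [] ; survivors = F ; length-centres = refl ; centres-unique = []
           ; centres⊆roots = λ () ; survivors-unique = uF ; survivors⊆ = λ j∈ → j∈
           ; length-survivors = r≤ ; survivors-unblocked = λ _ → All.[] }
  greedy-blockers root 0<b sparse self (suc k) r {[]} uF F⊆ len≥ =
    contradiction len≥ (<⇒≱ (≤-trans 0<b (≤-trans (m≤m+n b (k * b)) (m≤m+n _ r))))
  greedy-blockers root 0<b sparse self (suc k) r {j ∷ F} uF F⊆ len≥ = record
    { centres = root j ∷ centres
    ; survivors = survivors
    ; length-centres = cong suc length-centres
    ; centres-unique = All.tabulate c∉centres ∷ centres-unique
    ; centres⊆roots = centres⊆
    ; survivors-unique = survivors-unique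
    ; survivors⊆ = F₁⊆ ∘ survivors⊆
    ; length-survivors = length-survivors
    ; survivors-unblocked = λ j′∈ →
        proj₂ (∈-filter⁻ (∁? (blocks? (root j))) (survivors⊆ j′∈)) All.∷ survivors-unblocked j′∈
    }
    where
    F₁ = filter (∁? (blocks? (root j))) (j ∷ F)
    F₁⊆ : F₁ ⊆ˡ j ∷ F
    F₁⊆ = proj₁ ∘ ∈-filter⁻ (∁? (blocks? (root j)))
    F₁≥ : k * b + r ≤ length F₁
    F₁≥ = +-cancelˡ-≤ b _ _ (begin
      b + (k * b + r)   ≡⟨ +-assoc b _ r ⟨
      suc k * b + r     ≤⟨ len≥ ⟩
      length (j ∷ F)    ≤⟨ discard-blocked (sparse (F⊆ (here refl))) uF F⊆ ⟩
      b + length F₁     ∎)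
      where open ≤-Reasoning
    open Blockers (greedy-blockers root 0<b sparse self k r (Unique.filter⁺ (∁? (blocks? (root j))) uF) (F⊆ ∘ F₁⊆) F₁≥)
    -- A later centre is the root of a daisy that root j does not block, while root j blocks its own.
    c∉centres : ∀ {c} → c ∈ˡ centres → root j ≢ c
    c∉centres c∈ refl with ∈-map⁻ root (centres⊆roots c∈)
    ... | j′ , j′∈F₁ , rj≡rj′ = proj₂ (∈-filter⁻ (∁? (blocks? (root j))) j′∈F₁)
          (subst (λ c → Blocks c j′) (sym rj≡rj′) (self (F⊆ (F₁⊆ j′∈F₁))))
    centres⊆ : root j ∷ centres ⊆ˡ map root (j ∷ F)
    centres⊆ (here refl) = here refl
    centres⊆ (there c∈) with ∈-map⁻ root (centres⊆roots c∈)
    ... | j′ , j′∈F₁ , refl = ∈-map⁺ root (F₁⊆ j′∈F₁)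

-- Finite subsets as lists

module FinLists {k : ℕ} = WithDecEq (Fin._≟_ {k})

by-cases : ∀ {n} {C : Set} (a b : Fin n) → (a ≡ b → C) → (a ≢ b → C) → C
by-cases a b yes-case no-case = [ yes-case , no-case ]′ (toSum (a Fin.≟ b))

module _ {k : ℕ} where

  x∈tabulate⁻ : {f : Fin k → Bool} {x : Fin k} → x ∈ tabulate f → f x ≡ true
  x∈tabulate⁻ {f} {x} x∈ = trans (sym (lookup∘tabulate f x)) ([]=⇒lookup x∈)

  x∈tabulate⁺ : {f : Fin k → Bool} {x : Fin k} → f x ≡ true → x ∈ tabulate f
  x∈tabulate⁺ {f} {x} fx = lookup⇒[]= x _ (trans (lookup∘tabulate f x) fx)

elements : ∀ {k} → Subset k → List (Fin k)
elements [] = []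
elements (true ∷ p) = Fin.zero ∷ map Fin.suc (elements p)
elements (false ∷ p) = map Fin.suc (elements p)

elements-unique : ∀ {k} (p : Subset k) → Unique (elements p)
elements-unique [] = []
elements-unique (true ∷ p) = All.tabulate zero∉ ∷ Unique.map⁺ Finₚ.suc-injective (elements-unique p)
  where
  zero∉ : ∀ {x} → x ∈ˡ map Fin.suc (elements p) → Fin.zero ≢ x
  zero∉ x∈ refl with ∈-map⁻ Fin.suc x∈
  ... | _ , _ , ()
elements-unique (false ∷ p) = Unique.map⁺ Finₚ.suc-injective (elements-unique p)

∈-elements⁺ : ∀ {k} (p : Subset k) {x} → x ∈ p → x ∈ˡ elements p
∈-elements⁺ (true ∷ p) {Fin.zero} _ = here refl
∈-elements⁺ (true ∷ p) {Fin.suc x} x∈ = there (∈-map⁺ Fin.suc (∈-elements⁺ p (drop-there x∈)))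
∈-elements⁺ (false ∷ p) {Fin.suc x} x∈ = ∈-map⁺ Fin.suc (∈-elements⁺ p (drop-there x∈))

∈-elements⁻ : ∀ {k} (p : Subset k) {x} → x ∈ˡ elements p → x ∈ p
∈-elements⁻ (true ∷ p) (here refl) = Vec.here
∈-elements⁻ (true ∷ p) (there x∈) with ∈-map⁻ Fin.suc x∈
... | y , y∈ , refl = Vec.there (∈-elements⁻ p y∈)
∈-elements⁻ (false ∷ p) x∈ with ∈-map⁻ Fin.suc x∈
... | y , y∈ , refl = Vec.there (∈-elements⁻ p y∈)

length-elements : ∀ {k} (p : Subset k) → length (elements p) ≡ ∣ p ∣
length-elements [] = refl
length-elements (true ∷ p) = cong suc (trans (length-map Fin.suc (elements p)) (length-elements p))
length-elements (false ∷ p) = trans (length-map Fin.suc (elements p)) (length-elements p)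

module _ {k : ℕ} where

  ∣p∣≤length : (p : Subset k) (xs : List (Fin k)) → (∀ {x} → x ∈ p → x ∈ˡ xs) → ∣ p ∣ ≤ length xs
  ∣p∣≤length p xs p⊆xs = subst (_≤ length xs) (length-elements p)
    (FinLists.Unique-length-≤ (elements-unique p) (p⊆xs ∘ ∈-elements⁻ p))

  length≤∣p∣ : (p : Subset k) {xs : List (Fin k)} → Unique xs → (∀ {x} → x ∈ˡ xs → x ∈ p) → length xs ≤ ∣ p ∣
  length≤∣p∣ p uxs xs⊆p = subst (_ ≤_) (length-elements p)
    (FinLists.Unique-length-≤ uxs (∈-elements⁺ p ∘ xs⊆p))

  ∣p∣≡1⇒≡ : (p : Subset k) → ∣ p ∣ ≡ 1 → ∀ {x y} → x ∈ p → y ∈ p → x ≡ y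
  ∣p∣≡1⇒≡ p ∣p∣≡1 {x} {y} x∈p y∈p with x Fin.≟ y
  ... | yes x≡y = x≡y
  ... | no x≢y = contradiction (subst (2 ≤_) ∣p∣≡1 (length≤∣p∣ p distinct members)) (λ { (s≤s ()) })
    where
    distinct : Unique (x ∷ y ∷ [])
    distinct = All.tabulate (λ { (here refl) → x≢y ; (there ()) }) ∷ All.[] ∷ []
    members : ∀ {z} → z ∈ˡ x ∷ y ∷ [] → z ∈ p
    members (here refl) = x∈p
    members (there (here refl)) = y∈p

  ∣p∣>0⇒Nonempty : (p : Subset k) → 0 < ∣ p ∣ → Nonempty p
  ∣p∣>0⇒Nonempty p 0<∣p∣ with elements p | length-elements p | ∈-elements⁻ p
  ... | [] | 0≡∣p∣ | _ = contradiction (subst (0 <_) (sym 0≡∣p∣) 0<∣p∣) λ ()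
  ... | x ∷ _ | _ | members = x , members (here refl)

  fromList : List (Fin k) → Subset k
  fromList [] = ⊥
  fromList (x ∷ xs) = ⁅ x ⁆ ∪ fromList xs

  ∈-fromList⁺ : ∀ {xs x} → x ∈ˡ xs → x ∈ fromList xs
  ∈-fromList⁺ {x ∷ xs} (here refl) = x∈p∪q⁺ (inj₁ (x∈⁅x⁆ x))
  ∈-fromList⁺ {x ∷ xs} (there x∈) = x∈p∪q⁺ (inj₂ (∈-fromList⁺ x∈))

  ∈-fromList⁻ : ∀ {xs x} → x ∈ fromList xs → x ∈ˡ xs
  ∈-fromList⁻ {[]} x∈ = contradiction x∈ ∉⊥
  ∈-fromList⁻ {y ∷ xs} x∈ with x∈p∪q⁻ ⁅ y ⁆ (fromList xs) x∈
  ... | inj₁ x∈⁅y⁆ = here (x∈⁅y⁆⇒x≡y y x∈⁅y⁆)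
  ... | inj₂ x∈xs = there (∈-fromList⁻ x∈xs)

  ∣fromList∣ : ∀ {xs} → Unique xs → ∣ fromList xs ∣ ≡ length xs
  ∣fromList∣ {xs} uxs =
    ≤-antisym (∣p∣≤length (fromList xs) xs ∈-fromList⁻) (length≤∣p∣ (fromList xs) uxs ∈-fromList⁺)

x∈p─q⇒x∉q : ∀ {k} (p q : Subset k) {x} → x ∈ p ─ q → x ∉ q
x∈p─q⇒x∉q (_ ∷ p) (_ ∷ q) (Vec.there x∈) (Vec.there x∈q) = x∈p─q⇒x∉q p q x∈ x∈q
x∈p─q⇒x∉q (_ ∷ p) (true ∷ q) () Vec.here

x∈p∧y∉p⇒x≢y : ∀ {k} {p : Subset k} {x y} → x ∈ p → y ∉ p → x ≢ y
x∈p∧y∉p⇒x≢y x∈p y∉p refl = y∉p x∈p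

anyFin⁻ : ∀ {m} (f : Fin m → Bool) → anyFin f ≡ true → ∃ λ k → f k ≡ true
anyFin⁻ {suc m} f any with f Fin.zero in f0
... | true = Fin.zero , f0
... | false = let k , fk = anyFin⁻ (f ∘ Fin.suc) any in Fin.suc k , fk

anyFin⁺ : ∀ {m} (f : Fin m → Bool) (k : Fin m) → f k ≡ true → anyFin f ≡ true
anyFin⁺ f Fin.zero fk rewrite fk = refl
anyFin⁺ f (Fin.suc k) fk with f Fin.zero
... | true = refl
... | false = anyFin⁺ (f ∘ Fin.suc) k fk

module _ {k m : ℕ} (S : Fin m → Subset k) where

  ∈-bigU⁻ : ∀ {x} → x ∈ bigU S → ∃ λ l → x ∈ S l
  ∈-bigU⁻ {x} x∈ = let l , x∈Sl = anyFin⁻ (λ l → lookup (S l) x) (x∈tabulate⁻ x∈) in l , lookup⇒[]= x (S l) x∈Sl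

  ∈-bigU⁺ : ∀ {x} l → x ∈ S l → x ∈ bigU S
  ∈-bigU⁺ {x} l x∈Sl = x∈tabulate⁺ (anyFin⁺ (λ l → lookup (S l) x) l ([]=⇒lookup x∈Sl))

  unionList : List (Fin k)
  unionList = concat (List.tabulate (elements ∘ S))

  ∈-unionList⁻ : ∀ {x} → x ∈ˡ unionList → x ∈ bigU S
  ∈-unionList⁻ x∈ with ∈-concat⁻′ (List.tabulate (elements ∘ S)) x∈
  ... | xs , x∈xs , xs∈ with ∈-tabulate⁻ xs∈
  ... | l , refl = ∈-bigU⁺ l (∈-elements⁻ (S l) x∈xs)

  ∈-unionList⁺ : ∀ {x} → x ∈ bigU S → x ∈ˡ unionList
  ∈-unionList⁺ x∈ = let l , x∈Sl = ∈-bigU⁻ x∈ in ∈-concat⁺′ (∈-elements⁺ (S l) x∈Sl) (∈-tabulate⁺ l)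

length-unionList : ∀ {k m} (S : Fin m → Subset k) (c : ℕ) → (∀ l → ∣ S l ∣ ≡ c) → length (unionList S) ≡ m * c
length-unionList S c ∣S∣≡c = length-concat-tabulate (elements ∘ S) c (λ l → trans (length-elements (S l)) (∣S∣≡c l))

-- Graphs and induced copies of T(δ)

module _ (G : Graph) where
  open Graph G

  Adj-sym : ∀ {x y} → Adj G x y → Adj G y x
  Adj-sym {x} {y} x~y = trans (adj-sym y x) x~y

  Adj-irrefl : ∀ {x} → ¬ Adj G x x
  Adj-irrefl {x} x~x with () ← trans (sym x~x) (adj-irrefl x)

  Adj? : ∀ x y → Dec (Adj G x y)
  Adj? x y = adj x y Data.Bool.≟ true

  ∈-Nbhd⁻ : ∀ {x y} → y ∈ Nbhd G x → Adj G x y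
  ∈-Nbhd⁻ = x∈tabulate⁻

  ∈-Nbhd⁺ : ∀ {x y} → Adj G x y → y ∈ Nbhd G x
  ∈-Nbhd⁺ = x∈tabulate⁺

  ∈-N2 : ∀ {x z y} → Adj G x z → Adj G z y → y ∈ N2 G x
  ∈-N2 {x} {z} {y} x~z z~y = x∈tabulate⁺ (begin
    does (x Fin.≟ y) ∨ adj x y ∨ anyFin (λ u → adj x u ∧ adj u y)
      ≡⟨ cong (λ t → does (x Fin.≟ y) ∨ adj x y ∨ t) (anyFin⁺ _ z (cong₂ _∧_ x~z z~y)) ⟩
    does (x Fin.≟ y) ∨ adj x y ∨ true
      ≡⟨ cong (does (x Fin.≟ y) ∨_) (∨-zeroʳ (adj x y)) ⟩
    does (x Fin.≟ y) ∨ true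
      ≡⟨ ∨-zeroʳ _ ⟩
    true ∎)
    where open ≡-Reasoning

module _ (G : Graph) (d : ℕ) where
  open Graph G using (N)

  record TImage : Set where
    field
      h : Fin N
      c₁ m₂ c₂ : Fin d → Fin N
      ℓ₁ ℓ₂ : Fin d → Fin d → Fin N

      h~c₁ : ∀ a → Adj G h (c₁ a)
      c₁~ℓ₁ : ∀ a k → Adj G (c₁ a) (ℓ₁ a k)
      h~m₂ : ∀ a → Adj G h (m₂ a)
      m₂~c₂ : ∀ a → Adj G (m₂ a) (c₂ a)
      c₂~ℓ₂ : ∀ a k → Adj G (c₂ a) (ℓ₂ a k)

      h≁ℓ₁ : ∀ a k → ¬ Adj G h (ℓ₁ a k)
      h≁c₂ : ∀ a → ¬ Adj G h (c₂ a)
      h≁ℓ₂ : ∀ a k → ¬ Adj G h (ℓ₂ a k)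
      c₁≁c₁ : ∀ a b → ¬ Adj G (c₁ a) (c₁ b)
      c₁≁ℓ₁ : ∀ a b k → a ≢ b → ¬ Adj G (c₁ a) (ℓ₁ b k)
      c₁≁m₂ : ∀ a b → ¬ Adj G (c₁ a) (m₂ b)
      c₁≁c₂ : ∀ a b → ¬ Adj G (c₁ a) (c₂ b)
      c₁≁ℓ₂ : ∀ a b k → ¬ Adj G (c₁ a) (ℓ₂ b k)
      ℓ₁≁ℓ₁ : ∀ a k b k′ → ¬ Adj G (ℓ₁ a k) (ℓ₁ b k′)
      ℓ₁≁m₂ : ∀ a k b → ¬ Adj G (ℓ₁ a k) (m₂ b)
      ℓ₁≁c₂ : ∀ a k b → ¬ Adj G (ℓ₁ a k) (c₂ b)
      ℓ₁≁ℓ₂ : ∀ a k b k′ → ¬ Adj G (ℓ₁ a k) (ℓ₂ b k′)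
      m₂≁m₂ : ∀ a b → ¬ Adj G (m₂ a) (m₂ b)
      m₂≁c₂ : ∀ a b → a ≢ b → ¬ Adj G (m₂ a) (c₂ b)
      m₂≁ℓ₂ : ∀ a b k → ¬ Adj G (m₂ a) (ℓ₂ b k)
      c₂≁c₂ : ∀ a b → ¬ Adj G (c₂ a) (c₂ b)
      c₂≁ℓ₂ : ∀ a b k → a ≢ b → ¬ Adj G (c₂ a) (ℓ₂ b k)
      ℓ₂≁ℓ₂ : ∀ a k b k′ → ¬ Adj G (ℓ₂ a k) (ℓ₂ b k′)

      h≢c₁ : ∀ a → h ≢ c₁ a
      h≢ℓ₁ : ∀ a k → h ≢ ℓ₁ a k
      h≢m₂ : ∀ a → h ≢ m₂ a
      h≢c₂ : ∀ a → h ≢ c₂ a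
      h≢ℓ₂ : ∀ a k → h ≢ ℓ₂ a k
      c₁-injective : ∀ a b → c₁ a ≡ c₁ b → a ≡ b
      c₁≢ℓ₁ : ∀ a b k → c₁ a ≢ ℓ₁ b k
      c₁≢m₂ : ∀ a b → c₁ a ≢ m₂ b
      c₁≢c₂ : ∀ a b → c₁ a ≢ c₂ b
      c₁≢ℓ₂ : ∀ a b k → c₁ a ≢ ℓ₂ b k
      ℓ₁-injective : ∀ a k b k′ → ℓ₁ a k ≡ ℓ₁ b k′ → a ≡ b × k ≡ k′
      ℓ₁≢m₂ : ∀ a k b → ℓ₁ a k ≢ m₂ b
      ℓ₁≢c₂ : ∀ a k b → ℓ₁ a k ≢ c₂ b
      ℓ₁≢ℓ₂ : ∀ a k b k′ → ℓ₁ a k ≢ ℓ₂ b k′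
      m₂-injective : ∀ a b → m₂ a ≡ m₂ b → a ≡ b
      m₂≢c₂ : ∀ a b → m₂ a ≢ c₂ b
      m₂≢ℓ₂ : ∀ a b k → m₂ a ≢ ℓ₂ b k
      c₂-injective : ∀ a b → c₂ a ≡ c₂ b → a ≡ b
      c₂≢ℓ₂ : ∀ a b k → c₂ a ≢ ℓ₂ b k
      ℓ₂-injective : ∀ a k b k′ → ℓ₂ a k ≡ ℓ₂ b k′ → a ≡ b × k ≡ k′

  module _ (T : TImage) where
    open TImage T

    embed : TV G d → Fin N
    embed hd = h
    embed (c1 a) = c₁ a
    embed (l1 a k) = ℓ₁ a k
    embed (m2 a) = m₂ a
    embed (c2 a) = c₂ a
    embed (l2 a k) = ℓ₂ a k

    private
      edge⇒adj : ∀ x y → TE' G x y → Adj G (embed x) (embed y)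
      edge⇒adj _ _ (e-hc1 a) = h~c₁ a
      edge⇒adj _ _ (e-c1l a k) = c₁~ℓ₁ a k
      edge⇒adj _ _ (e-hm2 a) = h~m₂ a
      edge⇒adj _ _ (e-mc2 a) = m₂~c₂ a
      edge⇒adj _ _ (e-c2l a k) = c₂~ℓ₂ a k

      adj⇒edge : ∀ x y → Adj G (embed x) (embed y) → TE G x y
      adj⇒edge hd hd p = contradiction p (Adj-irrefl G)
      adj⇒edge hd (c1 b) p = inj₁ (e-hc1 b)
      adj⇒edge hd (l1 b k′) p = contradiction p (h≁ℓ₁ b k′)
      adj⇒edge hd (m2 b) p = inj₁ (e-hm2 b)
      adj⇒edge hd (c2 b) p = contradiction p (h≁c₂ b)
      adj⇒edge hd (l2 b k′) p = contradiction p (h≁ℓ₂ b k′)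
      adj⇒edge (c1 a) hd p = inj₂ (e-hc1 a)
      adj⇒edge (c1 a) (c1 b) p = contradiction p (c₁≁c₁ a b)
      adj⇒edge (c1 a) (l1 b k′) p with a Fin.≟ b
      ... | yes refl = inj₁ (e-c1l a k′)
      ... | no a≢b = contradiction p (c₁≁ℓ₁ a b k′ a≢b)
      adj⇒edge (c1 a) (m2 b) p = contradiction p (c₁≁m₂ a b)
      adj⇒edge (c1 a) (c2 b) p = contradiction p (c₁≁c₂ a b)
      adj⇒edge (c1 a) (l2 b k′) p = contradiction p (c₁≁ℓ₂ a b k′)
      adj⇒edge (l1 a k) hd p = contradiction (Adj-sym G p) (h≁ℓ₁ a k)
      adj⇒edge (l1 a k) (c1 b) p with b Fin.≟ a
      ... | yes refl = inj₂ (e-c1l b k)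
      ... | no b≢a = contradiction (Adj-sym G p) (c₁≁ℓ₁ b a k b≢a)
      adj⇒edge (l1 a k) (l1 b k′) p = contradiction p (ℓ₁≁ℓ₁ a k b k′)
      adj⇒edge (l1 a k) (m2 b) p = contradiction p (ℓ₁≁m₂ a k b)
      adj⇒edge (l1 a k) (c2 b) p = contradiction p (ℓ₁≁c₂ a k b)
      adj⇒edge (l1 a k) (l2 b k′) p = contradiction p (ℓ₁≁ℓ₂ a k b k′)
      adj⇒edge (m2 a) hd p = inj₂ (e-hm2 a)
      adj⇒edge (m2 a) (c1 b) p = contradiction (Adj-sym G p) (c₁≁m₂ b a)
      adj⇒edge (m2 a) (l1 b k′) p = contradiction (Adj-sym G p) (ℓ₁≁m₂ b k′ a)
      adj⇒edge (m2 a) (m2 b) p = contradiction p (m₂≁m₂ a b)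
      adj⇒edge (m2 a) (c2 b) p with a Fin.≟ b
      ... | yes refl = inj₁ (e-mc2 a)
      ... | no a≢b = contradiction p (m₂≁c₂ a b a≢b)
      adj⇒edge (m2 a) (l2 b k′) p = contradiction p (m₂≁ℓ₂ a b k′)
      adj⇒edge (c2 a) hd p = contradiction (Adj-sym G p) (h≁c₂ a)
      adj⇒edge (c2 a) (c1 b) p = contradiction (Adj-sym G p) (c₁≁c₂ b a)
      adj⇒edge (c2 a) (l1 b k′) p = contradiction (Adj-sym G p) (ℓ₁≁c₂ b k′ a)
      adj⇒edge (c2 a) (m2 b) p with b Fin.≟ a
      ... | yes refl = inj₂ (e-mc2 b)
      ... | no b≢a = contradiction (Adj-sym G p) (m₂≁c₂ b a b≢a)
      adj⇒edge (c2 a) (c2 b) p = contradiction p (c₂≁c₂ a b)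
      adj⇒edge (c2 a) (l2 b k′) p with a Fin.≟ b
      ... | yes refl = inj₁ (e-c2l a k′)
      ... | no a≢b = contradiction p (c₂≁ℓ₂ a b k′ a≢b)
      adj⇒edge (l2 a k) hd p = contradiction (Adj-sym G p) (h≁ℓ₂ a k)
      adj⇒edge (l2 a k) (c1 b) p = contradiction (Adj-sym G p) (c₁≁ℓ₂ b a k)
      adj⇒edge (l2 a k) (l1 b k′) p = contradiction (Adj-sym G p) (ℓ₁≁ℓ₂ b k′ a k)
      adj⇒edge (l2 a k) (m2 b) p = contradiction (Adj-sym G p) (m₂≁ℓ₂ b a k)
      adj⇒edge (l2 a k) (c2 b) p with b Fin.≟ a
      ... | yes refl = inj₂ (e-c2l b k)
      ... | no b≢a = contradiction (Adj-sym G p) (c₂≁ℓ₂ b a k b≢a)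
      adj⇒edge (l2 a k) (l2 b k′) p = contradiction p (ℓ₂≁ℓ₂ a k b k′)

      embed-injective : ∀ x y → embed x ≡ embed y → x ≡ y
      embed-injective hd hd e = refl
      embed-injective hd (c1 b) e = contradiction e (h≢c₁ b)
      embed-injective hd (l1 b k′) e = contradiction e (h≢ℓ₁ b k′)
      embed-injective hd (m2 b) e = contradiction e (h≢m₂ b)
      embed-injective hd (c2 b) e = contradiction e (h≢c₂ b)
      embed-injective hd (l2 b k′) e = contradiction e (h≢ℓ₂ b k′)
      embed-injective (c1 a) hd e = contradiction (sym e) (h≢c₁ a)
      embed-injective (c1 a) (c1 b) e = cong c1 (c₁-injective a b e)
      embed-injective (c1 a) (l1 b k′) e = contradiction e (c₁≢ℓ₁ a b k′)
      embed-injective (c1 a) (m2 b) e = contradiction e (c₁≢m₂ a b)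
      embed-injective (c1 a) (c2 b) e = contradiction e (c₁≢c₂ a b)
      embed-injective (c1 a) (l2 b k′) e = contradiction e (c₁≢ℓ₂ a b k′)
      embed-injective (l1 a k) hd e = contradiction (sym e) (h≢ℓ₁ a k)
      embed-injective (l1 a k) (c1 b) e = contradiction (sym e) (c₁≢ℓ₁ b a k)
      embed-injective (l1 a k) (l1 b k′) e with ℓ₁-injective a k b k′ e
      ... | refl , refl = refl
      embed-injective (l1 a k) (m2 b) e = contradiction e (ℓ₁≢m₂ a k b)
      embed-injective (l1 a k) (c2 b) e = contradiction e (ℓ₁≢c₂ a k b)
      embed-injective (l1 a k) (l2 b k′) e = contradiction e (ℓ₁≢ℓ₂ a k b k′)
      embed-injective (m2 a) hd e = contradiction (sym e) (h≢m₂ a)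
      embed-injective (m2 a) (c1 b) e = contradiction (sym e) (c₁≢m₂ b a)
      embed-injective (m2 a) (l1 b k′) e = contradiction (sym e) (ℓ₁≢m₂ b k′ a)
      embed-injective (m2 a) (m2 b) e = cong m2 (m₂-injective a b e)
      embed-injective (m2 a) (c2 b) e = contradiction e (m₂≢c₂ a b)
      embed-injective (m2 a) (l2 b k′) e = contradiction e (m₂≢ℓ₂ a b k′)
      embed-injective (c2 a) hd e = contradiction (sym e) (h≢c₂ a)
      embed-injective (c2 a) (c1 b) e = contradiction (sym e) (c₁≢c₂ b a)
      embed-injective (c2 a) (l1 b k′) e = contradiction (sym e) (ℓ₁≢c₂ b k′ a)
      embed-injective (c2 a) (m2 b) e = contradiction (sym e) (m₂≢c₂ b a)
      embed-injective (c2 a) (c2 b) e = cong c2 (c₂-injective a b e)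
      embed-injective (c2 a) (l2 b k′) e = contradiction e (c₂≢ℓ₂ a b k′)
      embed-injective (l2 a k) hd e = contradiction (sym e) (h≢ℓ₂ a k)
      embed-injective (l2 a k) (c1 b) e = contradiction (sym e) (c₁≢ℓ₂ b a k)
      embed-injective (l2 a k) (l1 b k′) e = contradiction (sym e) (ℓ₁≢ℓ₂ b k′ a k)
      embed-injective (l2 a k) (m2 b) e = contradiction (sym e) (m₂≢ℓ₂ b a k)
      embed-injective (l2 a k) (c2 b) e = contradiction (sym e) (c₂≢ℓ₂ b a k)
      embed-injective (l2 a k) (l2 b k′) e with ℓ₂-injective a k b k′ e
      ... | refl , refl = refl

    hasInducedT : HasInducedT G d
    hasInducedT = embed , embed-injective , λ x y → mk⇔ [ edge⇒adj x y , Adj-sym G ∘ edge⇒adj y x ]′ (adj⇒edge x y)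

cardinalityFactor : ℕ → ℕ → ℕ → ℕ → ℕ
cardinalityFactor q s τ δ = 1 + (q + s) * (δ * δ + 1) + 2 * δ + δ * τ

-- The daisies discarded for the hub, for the τδ centres and for the δ² leaves, plus the (1 + 2q)δ
-- needed to select δ daisies whose roots see no other eye.
threshold : ℕ → ℕ → ℕ → ℕ → ℕ
threshold q s τ δ = (q + s) + (τ * δ * (q + s) + (δ * δ * (q + s) + (1 + 2 * q) * δ))

private
  reassoc : ∀ q τ δ a → q * τ * (δ * δ) * a ≡ q * τ * (δ * δ * a)
  reassoc = solve-∀

  triple : ∀ q → q + 2 * q ≡ 3 * q
  triple = solve-∀

  regroup : ∀ m a δ → m + (m * a + (m * (δ * δ * a) + (m * (δ * δ * a) + 3 * m * δ)))
                      ≡ m * (1 + a * (δ * δ + 1) + a * (δ * δ) + 3 * δ)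
  regroup = solve-∀

  spread : ∀ m a δ τ → m * (1 + a * (δ * δ + 1) + a * (δ * δ) + 3 * δ + (1 + a + δ + 2 * (δ * τ)))
                       ≡ m * (2 * (1 + a * (δ * δ + 1) + 2 * δ + δ * τ))
  spread = solve-∀

  *-assoc-2qτ : ∀ q τ x → q * τ * (2 * x) ≡ 2 * q * τ * x
  *-assoc-2qτ = solve-∀

-- With m = qτ ≥ 1, each summand of q + threshold is at most m times a summand of the factor.
q+threshold<2qτ·factor : ∀ q s τ δ → 1 ≤ q → 1 ≤ τ → 1 ≤ δ →
  q + threshold q s τ δ < 2 * q * τ * cardinalityFactor q s τ δ
q+threshold<2qτ·factor q s τ δ 1≤q 1≤τ 1≤δ = begin-strict
  q + threshold q s τ δ
    ≤⟨ +-mono-≤ q≤m (+-mono-≤ a≤ma (+-mono-≤ τδa≤mδδa (+-mono-≤ δδa≤mδδa (*-monoˡ-≤ δ 1+2q≤3m)))) ⟩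
  m + (m * a + (m * (δ * δ * a) + (m * (δ * δ * a) + 3 * m * δ)))
    ≡⟨ regroup m a δ ⟩
  m * (1 + a * (δ * δ + 1) + a * (δ * δ) + 3 * δ)
    <⟨ *-monoʳ-< m (m<m+n _ (s≤s z≤n)) ⟩
  m * (1 + a * (δ * δ + 1) + a * (δ * δ) + 3 * δ + (1 + a + δ + 2 * (δ * τ)))
    ≡⟨ spread m a δ τ ⟩
  m * (2 * (1 + a * (δ * δ + 1) + 2 * δ + δ * τ))
    ≡⟨ *-assoc-2qτ q τ (cardinalityFactor q s τ δ) ⟩
  2 * q * τ * cardinalityFactor q s τ δ ∎
  where
  open ≤-Reasoning
  m = q * τ
  a = q + s
  instance
    _ = >-nonZero 1≤q
    _ = >-nonZero 1≤τ
    _ = >-nonZero 1≤δ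
    _ = >-nonZero (*-mono-≤ 1≤q 1≤τ)
  q≤m : q ≤ m
  q≤m = m≤m*n q τ
  a≤ma : a ≤ m * a
  a≤ma = m≤n*m a m
  τδa≤mδδa : τ * δ * a ≤ m * (δ * δ * a)
  τδa≤mδδa = ≤-trans (*-monoˡ-≤ a (*-mono-≤ (m≤n*m τ q) (m≤m*n δ δ))) (≤-reflexive (reassoc q τ δ a))
  δδa≤mδδa : δ * δ * a ≤ m * (δ * δ * a)
  δδa≤mδδa = m≤n*m (δ * δ * a) m
  1+2q≤3m : 1 + 2 * q ≤ 3 * m
  1+2q≤3m = ≤-trans (+-monoˡ-≤ (2 * q) 1≤q) (≤-trans (≤-reflexive (triple q)) (*-monoʳ-≤ 3 q≤m))

βζ[q+threshold]<card : ∀ q s τ δ ζ β → 1 ≤ q → 1 ≤ τ → 1 ≤ δ → 1 ≤ ζ → 1 ≤ β →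
  β * ζ * (q + threshold q s τ δ) < 2 * q * ζ * β * cardinalityFactor q s τ δ * τ
βζ[q+threshold]<card q s τ δ ζ β 1≤q 1≤τ 1≤δ 1≤ζ 1≤β = begin-strict
  β * ζ * (q + threshold q s τ δ)                 <⟨ *-monoʳ-< (β * ζ) (q+threshold<2qτ·factor q s τ δ 1≤q 1≤τ 1≤δ) ⟩
  β * ζ * (2 * q * τ * cardinalityFactor q s τ δ) ≡⟨ rearrange q ζ β (cardinalityFactor q s τ δ) τ ⟩
  2 * q * ζ * β * cardinalityFactor q s τ δ * τ   ∎
  where
  open ≤-Reasoning
  instance _ = >-nonZero (*-mono-≤ 1≤β 1≤ζ)
  rearrange : ∀ q ζ β x τ → β * ζ * (2 * q * τ * x) ≡ 2 * q * ζ * β * x * τ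
  rearrange = solve-∀

module Bunch
  (τ α δ β : ℕ) (α≥1 : 1 ≤ α) (δ≥1 : 1 ≤ δ) (β≥2 : 2 ≤ β)
  (η ζ q s : ℕ) (η≥1 : 1 ≤ η) (α≤ζ : α ≤ ζ)
  (G : Graph) (χ²≤τ : ∀ v → ChiLe G (N2 G v) τ)
  (n : ℕ) (P : Fin n → Fin β → Subset (Graph.N G)) (H : Fin n → Subset (Graph.N G))
  (U : Subset (Graph.N G))
  (array : IsTemplateArray G α β P H U ζ η) (cleaned : TwoCleaned G α β P H U)
  (Π : Subset (Graph.N G)) (privatization : IsPrivatization G α β P H U δ τ Π)
  (B : Fin n → Subset (Graph.N G)) (shadowing : IsShadowing G α β P H U B)
  (degree : ShadowDegreeLe G α β P H U B (U ─ Π) s)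
  (i : Fin n) (J : Subset n) (root eye : Fin n → Fin (Graph.N G))
  (pet : Fin n → Subset (Graph.N G))
  (bunch : IsBunch G α β P H U δ B i J root eye pet)
  (avoidsΠ : ∀ j → j ∈ J → root j ∉ Π × eye j ∉ Π × (∀ p → p ∈ pet j → p ∉ Π))
  (card : ∣ J ∣ ≡ 2 * q * ζ * β * cardinalityFactor q s τ δ * τ)
  where

  open Graph G using (N; adj)

  V : Set
  V = Fin N

  Y Z H𝒯 Y𝒯 Z𝒯 V𝒯 : Subset N
  Y = Yi G α β P H U i
  Z = H i ─ Y
  H𝒯 = HT G α β P H U
  Y𝒯 = YT G α β P H U
  Z𝒯 = ZT G α β P H U
  V𝒯 = VT G α β P H U

  core-size : ∀ k p → ∣ P k p ∣ ≡ ζ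
  core-size k = let (sizes , _) , _ = proj₁ (proj₁ array) k in sizes

  core⊆H : ∀ {k v} → v ∈ Yi G α β P H U k → v ∈ H k
  core⊆H {k} = let _ , Y⊆H , _ = proj₁ (proj₁ array) k in Y⊆H

  mixed : ∀ {k v} → v ∈ H k → ∃ λ p → η ≤ ∣ P k p ∩ Nbhd G v ∣
  mixed {k} {v} v∈H = let _ , _ , mixed-on = proj₁ (proj₁ array) k in proj₂ (mixed-on v v∈H)

  H-disjoint : ∀ {k l v} → v ∈ H k → v ∈ H l → k ≡ l
  H-disjoint {k} {l} {v} v∈Hk v∈Hl with Finₚ.<-cmp k l
  ... | tri< k<l _ _ = contradiction v∈Hl (proj₁ (proj₂ (proj₁ array) k l k<l) v v∈Hk)
  ... | tri≈ _ k≡l _ = k≡l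
  ... | tri> _ _ l<k = contradiction v∈Hk (proj₁ (proj₂ (proj₁ array) l k l<k) v v∈Hl)

  U∉H𝒯 : ∀ {v} → v ∈ U → v ∉ H𝒯
  U∉H𝒯 {v} v∈U v∈H𝒯 = let k , v∈Hk = ∈-bigU⁻ H v∈H𝒯 in proj₁ (proj₂ array v v∈U) k v∈Hk

  Z-stable : Stable G Z
  Z-stable = proj₂ (proj₂ cleaned) i

  Π⊆U : ∀ {v} → v ∈ Π → v ∈ U
  Π⊆U = proj₁ privatization

  Π-unique-Z-neighbour : ∀ {v} → v ∈ Π → ∣ Z𝒯 ∩ Nbhd G v ∣ ≡ 1
  Π-unique-Z-neighbour {v} v∈Π = proj₁ (proj₁ (proj₂ (proj₂ privatization)) v v∈Π)

  Π≁Y𝒯 : ∀ {v y} → v ∈ Π → y ∈ Y𝒯 → ¬ Adj G v y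
  Π≁Y𝒯 {v} {y} v∈Π = proj₂ (proj₁ (proj₂ (proj₂ privatization)) v v∈Π) y

  ∣Π∩N∣ : ∀ {z} → z ∈ Z𝒯 → ∣ Π ∩ Nbhd G z ∣ ≡ δ * τ
  ∣Π∩N∣ {z} = proj₂ (proj₂ (proj₂ privatization)) z

  U⊆⋃B : ∀ {v} → v ∈ U → ∃ λ k → v ∈ B k
  U⊆⋃B {v} v∈U = ∈-bigU⁻ B (Equivalence.to (proj₁ (proj₂ shadowing) v) v∈U)

  B⊆U : ∀ {k v} → v ∈ B k → v ∈ U
  B⊆U {k} {v} v∈Bk = Equivalence.from (proj₁ (proj₂ shadowing) v) (∈-bigU⁺ B k v∈Bk)

  B-attached : ∀ {k v} → v ∈ B k → ∃ λ w → w ∈ H k × Adj G v w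
  B-attached {k} {v} = proj₂ (proj₂ shadowing) k v

  record DaisyFacts (j : Fin n) : Set where
    field
      root∈H : root j ∈ H i
      pet⊆B : ∀ {p} → p ∈ pet j → p ∈ B j
      ∣pet∣ : ∣ pet j ∣ ≡ δ
      eye∉pet : eye j ∉ pet j
      root~eye : Adj G (root j) (eye j)
      eye~pet : ∀ {p} → p ∈ pet j → Adj G (eye j) p
      root≁pet : ∀ {p} → p ∈ pet j → ¬ Adj G (root j) p
      pet-stable : ∀ {p p′} → p ∈ pet j → p′ ∈ pet j → ¬ Adj G p p′
      eye∉H𝒯 : eye j ∉ H𝒯
      pet∉H𝒯 : ∀ {p} → p ∈ pet j → p ∉ H𝒯
      eye∉Π : eye j ∉ Π
      pet∉Π : ∀ {p} → p ∈ pet j → p ∉ Π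

  daisy : ∀ {j} → j ∈ J → DaisyFacts j
  daisy {j} j∈J =
    let r∈H , _ , pet⊆B , _ , ∣pet∣ , _ , e∉pet , _ , r~e , e~p , r≁p , p-stable , e∉H𝒯 , p∉H𝒯 = proj₁ (proj₂ bunch) j j∈J
        _ , e∉Π , p∉Π = avoidsΠ j j∈J
    in record
      { root∈H = r∈H ; pet⊆B = pet⊆B ; ∣pet∣ = ∣pet∣ ; eye∉pet = e∉pet ; root~eye = r~e
      ; eye~pet = e~p _ ; root≁pet = r≁p _ ; pet-stable = p-stable _ _ ; eye∉H𝒯 = e∉H𝒯
      ; pet∉H𝒯 = p∉H𝒯 _ ; eye∉Π = e∉Π ; pet∉Π = p∉Π _ }

  flower : Fin n → Subset N
  flower j = pet j ∪ ⁅ eye j ⁆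

  eye∈flower : ∀ j → eye j ∈ flower j
  eye∈flower j = x∈p∪q⁺ (inj₂ (x∈⁅x⁆ (eye j)))

  pet⊆flower : ∀ {j p} → p ∈ pet j → p ∈ flower j
  pet⊆flower p∈ = x∈p∪q⁺ (inj₁ p∈)

  module _ {j j′} (j∈J : j ∈ J) (j′∈J : j′ ∈ J) (j≢j′ : j ≢ j′) where

    private
      pair = proj₂ (proj₂ bunch) j j′ j∈J j′∈J j≢j′

    flower-disjoint : ∀ {x} → x ∈ flower j → x ∉ flower j′
    flower-disjoint = proj₁ pair _

    flower-nonadjacent : ∀ {x y} → x ∈ flower j → y ∈ flower j′ → ¬ Adj G x y
    flower-nonadjacent = proj₁ (proj₂ pair) _ _

    root≁other-pet : ∀ {p} → p ∈ pet j′ → ¬ Adj G (root j) p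
    root≁other-pet = proj₂ (proj₂ pair) _

  PetAdj : V → Fin n → Set
  PetAdj w j = ∃ λ p → p ∈ pet j × Adj G w p

  petAdj? : ∀ w → Decidable (PetAdj w)
  petAdj? w j = Finₚ.any? (λ p → (p ∈? pet j) ×-dec Adj? G w p)

  Good Blocks : V → Fin n → Set
  Good w j = Adj G w (eye j) × ¬ PetAdj w j
  Blocks w j = Adj G w (eye j) ⊎ PetAdj w j

  good? : ∀ w → Decidable (Good w)
  good? w j = Adj? G w (eye j) ×-dec ¬? (petAdj? w j)

  blocks? : ∀ w → Decidable (Blocks w)
  blocks? w j = Adj? G w (eye j) ⊎-dec petAdj? w j

  daisies : List (Fin n)
  daisies = elements J

  daisies-unique : Unique daisies
  daisies-unique = elements-unique J

  goodFor : V → List (Fin n)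
  goodFor w = filter (good? w) daisies

  ∈-goodFor⁻ : ∀ {w j} → j ∈ˡ goodFor w → j ∈ J × Good w j
  ∈-goodFor⁻ {w} j∈ = let j∈daisies , good = ∈-filter⁻ (good? w) {xs = daisies} j∈ in ∈-elements⁻ J j∈daisies , good

  Candidate : V → Set
  Candidate w = w ∈ H i ⊎ w ∈ B i

  FewGood : Set
  FewGood = ∀ w → Candidate w → length (goodFor w) < q

  Conclusion : Set
  Conclusion = Σ V λ u → Candidate u ×
    Σ (Subset n) λ J′ → J′ ⊆ J × ∣ J′ ∣ ≡ q ×
      (∀ j → j ∈ J′ → Adj G u (eye j) × (∀ p → p ∈ pet j → ¬ Adj G u p))

  conclusion : ∀ w → Candidate w → q ≤ length (goodFor w) → Conclusion
  conclusion w cand q≤ = w , cand , fromList chosen , chosen⊆J , ∣chosen∣ , chosen-good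
    where
    chosen = take q (goodFor w)
    chosen⊆goodFor : ∀ {j} → j ∈ˡ chosen → j ∈ˡ goodFor w
    chosen⊆goodFor j∈ = subst (_ ∈ˡ_) (take++drop≡id q (goodFor w)) (∈-++⁺ˡ j∈)
    chosen⊆J : fromList chosen ⊆ J
    chosen⊆J j∈ = proj₁ (∈-goodFor⁻ (chosen⊆goodFor (∈-fromList⁻ j∈)))
    ∣chosen∣ : ∣ fromList chosen ∣ ≡ q
    ∣chosen∣ = trans (∣fromList∣ (Unique.take⁺ q (Unique.filter⁺ (good? w) daisies-unique)))
                     (trans (length-take q (goodFor w)) (m≤n⇒m⊓n≡m q≤))
    chosen-good : ∀ j → j ∈ fromList chosen → Adj G w (eye j) × (∀ p → p ∈ pet j → ¬ Adj G w p)
    chosen-good j j∈ = let w~eye , ¬petAdj = proj₂ (∈-goodFor⁻ (chosen⊆goodFor (∈-fromList⁻ j∈)))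
                       in w~eye , λ p p∈ w~p → ¬petAdj (p , p∈ , w~p)

  dichotomy : Conclusion ⊎ FewGood
  dichotomy with Finₚ.any? (λ w → (w ∈? H i ⊎-dec w ∈? B i) ×-dec (q ≤? length (goodFor w)))
  ... | yes (w , cand , q≤) = inj₁ (conclusion w cand q≤)
  ... | no none = inj₂ λ w cand → ≰⇒> λ q≤ → none (w , cand , q≤)

  Z⊆Z𝒯 : ∀ {z} → z ∈ Z → z ∈ Z𝒯
  Z⊆Z𝒯 {z} z∈Z = x∈p∧x∉q⇒x∈p─q (∈-bigU⁺ H i z∈H) z∉Y𝒯
    where
    z∈H = p─q⊆p (H i) Y z∈Z
    z∉Y𝒯 : z ∉ Y𝒯
    z∉Y𝒯 z∈Y𝒯 = let k , z∈Yk = ∈-bigU⁻ (Yi G α β P H U) z∈Y𝒯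
                in x∈p─q⇒x∉q (H i) Y z∈Z (subst (λ l → z ∈ Yi G α β P H U l) (H-disjoint (core⊆H z∈Yk) z∈H) z∈Yk)

  unique-Z𝒯-neighbour : ∀ {x w w′} → x ∈ Π → w ∈ Z𝒯 → Adj G x w → w′ ∈ Z𝒯 → Adj G x w′ → w ≡ w′
  unique-Z𝒯-neighbour x∈Π w∈ x~w w′∈ x~w′ =
    ∣p∣≡1⇒≡ _ (Π-unique-Z-neighbour x∈Π) (x∈p∩q⁺ (w∈ , ∈-Nbhd⁺ G x~w)) (x∈p∩q⁺ (w′∈ , ∈-Nbhd⁺ G x~w′))

  -- The vertex of H that x ∈ B_k is attached to lies in Z𝒯, since x has no neighbour in Y𝒯;
  -- being x's only neighbour in Z𝒯, it is z.
  Π-neighbour-of-Z∈B : ∀ {z x} → z ∈ Z → x ∈ Π → Adj G z x → x ∈ B i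
  Π-neighbour-of-Z∈B {z} {x} z∈Z x∈Π z~x =
    let k , x∈Bk = U⊆⋃B (Π⊆U x∈Π)
        w , w∈Hk , x~w = B-attached x∈Bk
        w∈Z𝒯 = x∈p∧x∉q⇒x∈p─q (∈-bigU⁺ H k w∈Hk) (λ w∈Y𝒯 → Π≁Y𝒯 x∈Π w∈Y𝒯 x~w)
        w≡z = unique-Z𝒯-neighbour x∈Π w∈Z𝒯 x~w (Z⊆Z𝒯 z∈Z) (Adj-sym G z~x)
    in subst (λ l → x ∈ B l) (H-disjoint w∈Hk (subst (_∈ H i) (sym w≡z) (p─q⊆p (H i) Y z∈Z))) x∈Bk

  root≁pet-of : ∀ {j j′} → j ∈ J → j′ ∈ J → ¬ PetAdj (root j) j′
  root≁pet-of {j} {j′} j∈J j′∈J (_ , p∈pet , root~p) = by-cases j j′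
    (λ { refl → DaisyFacts.root≁pet (daisy j∈J) p∈pet root~p })
    (λ j≢j′ → root≁other-pet j∈J j′∈J j≢j′ p∈pet root~p)

  root-good : ∀ {j} → j ∈ J → Good (root j) j
  root-good j∈J = DaisyFacts.root~eye (daisy j∈J) , root≁pet-of j∈J j∈J

  module FromFewGood (few : FewGood) where

    vertex-of-H : ∃ λ v → v ∈ H i
    vertex-of-H =
      let p₀ = Fin.fromℕ< β≥2
          v , v∈part = ∣p∣>0⇒Nonempty (P i p₀) (subst (1 ≤_) (sym (core-size i p₀)) (≤-trans α≥1 α≤ζ))
      in v , core⊆H (∈-bigU⁺ (P i) p₀ v∈part)

    q≥1 : 1 ≤ q
    q≥1 = let v , v∈H = vertex-of-H in ≤-trans (s≤s z≤n) (few v (inj₁ v∈H))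

    τ≥1 : 1 ≤ τ
    τ≥1 = let v , _ = vertex-of-H in inhabited (proj₁ (χ²≤τ v) v)
      where
      inhabited : ∀ {m} → Fin m → 1 ≤ m
      inhabited {suc m} _ = s≤s z≤n

    candidate∈V𝒯 : ∀ {w} → Candidate w → w ∈ V𝒯
    candidate∈V𝒯 (inj₁ w∈H) = x∈p∪q⁺ (inj₁ (∈-bigU⁺ H i w∈H))
    candidate∈V𝒯 (inj₂ w∈B) = x∈p∪q⁺ (inj₂ (B⊆U w∈B))

    petAdj-≤ : ∀ {w} → Candidate w → length (filter (petAdj? w) daisies) ≤ s
    petAdj-≤ {w} cand = ≤-trans (length≤∣p∣ seen (Unique.filter⁺ (petAdj? w) daisies-unique) shadowed)
                                (degree w (candidate∈V𝒯 cand))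
      where
      seen : Subset n
      seen = tabulate (λ k → anyFin (λ x → lookup (B k) x ∧ lookup (U ─ Π) x ∧ adj w x))
      shadowed : ∀ {j} → j ∈ˡ filter (petAdj? w) daisies → j ∈ seen
      shadowed {j} j∈ =
        let j∈daisies , p , p∈pet , w~p = ∈-filter⁻ (petAdj? w) {xs = daisies} j∈
            open DaisyFacts (daisy (∈-elements⁻ J j∈daisies))
            p∈U─Π = x∈p∧x∉q⇒x∈p─q (B⊆U (pet⊆B p∈pet)) (pet∉Π p∈pet)
        in x∈tabulate⁺ (anyFin⁺ _ p (cong₂ _∧_ ([]=⇒lookup (pet⊆B p∈pet)) (cong₂ _∧_ ([]=⇒lookup p∈U─Π) w~p)))

    blocked-≤ : ∀ {w} → Candidate w → length (filter (blocks? w) daisies) ≤ q + s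
    blocked-≤ {w} cand = begin
      length (filter (blocks? w) daisies)                                    ≤⟨ length-filter-mono (blocks? w) (good? w ∪? petAdj? w) good-or-petAdj daisies ⟩
      length (filter (good? w ∪? petAdj? w) daisies)                         ≤⟨ length-filter-∪ (good? w) (petAdj? w) daisies ⟩
      length (goodFor w) + length (filter (petAdj? w) daisies)               ≤⟨ +-mono-≤ (<⇒≤ (few w cand)) (petAdj-≤ cand) ⟩
      q + s                                                                  ∎
      where
      open ≤-Reasoning
      good-or-petAdj : ∀ {j} → Blocks w j → Good w j ⊎ PetAdj w j
      good-or-petAdj {j} (inj₁ w~eye) = [ inj₂ , (λ ¬petAdj → inj₁ (w~eye , ¬petAdj)) ]′ (toSum (petAdj? w j))
      good-or-petAdj (inj₂ petAdj) = inj₂ petAdj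

    open Blocking Fin._≟_ blocks? daisies (q + s)

    root-sparse : ∀ {j} → j ∈ˡ daisies → Sparse (root j)
    root-sparse j∈ = blocked-≤ (inj₁ (DaisyFacts.root∈H (daisy (∈-elements⁻ J j∈))))

    root-blocks : ∀ {j} → j ∈ˡ daisies → Blocks (root j) j
    root-blocks j∈ = inj₁ (DaisyFacts.root~eye (daisy (∈-elements⁻ J j∈)))

    coreVertices : List V
    coreVertices = unionList (P i)

    rootInY? : Decidable (λ j → root j ∈ Y)
    rootInY? j = root j ∈? Y

    rootedInY rootedOutside : List (Fin n)
    rootedInY = filter rootInY? daisies
    rootedOutside = filter (∁? rootInY?) daisies

    rootedInY-≤ : length rootedInY ≤ length coreVertices * q
    rootedInY-≤ = ≮⇒≥ λ many →
      let y , y∈core , q<fibre = pigeonhole (λ j y → root j Fin.≟ y) q coreVertices rootedInY root∈core many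
      in <-irrefl refl (<-trans (<-≤-trans q<fibre (fibre≤goodFor y)) (few y (inj₁ (core⊆H (∈-unionList⁻ (P i) y∈core)))))
      where
      root∈core : ∀ {j} → j ∈ˡ rootedInY → ∃ λ y → y ∈ˡ coreVertices × root j ≡ y
      root∈core {j} j∈ = root j , ∈-unionList⁺ (P i) (proj₂ (∈-filter⁻ rootInY? {xs = daisies} j∈)) , refl
      fibre≤goodFor : ∀ y → length (filter (λ j → root j Fin.≟ y) rootedInY) ≤ length (goodFor y)
      fibre≤goodFor y = FinLists.Unique-length-≤ (Unique.filter⁺ _ (Unique.filter⁺ rootInY? daisies-unique)) λ j∈ →
        let j∈rootedInY , root≡y = ∈-filter⁻ (λ j → root j Fin.≟ y) {xs = rootedInY} j∈
            j∈daisies = proj₁ (∈-filter⁻ rootInY? {xs = daisies} j∈rootedInY)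
        in ∈-filter⁺ (good? y) j∈daisies (subst (λ w → Good w _) root≡y (root-good (∈-elements⁻ J j∈daisies)))

    rootedOutside-big : length coreVertices * threshold q s τ δ < length rootedOutside
    rootedOutside-big = +-cancelˡ-< (length coreVertices * q) _ _ (begin-strict
      length coreVertices * q + length coreVertices * threshold q s τ δ ≡⟨ *-distribˡ-+ (length coreVertices) q _ ⟨
      length coreVertices * (q + threshold q s τ δ)                     ≡⟨ cong (_* (q + threshold q s τ δ)) (length-unionList (P i) ζ (core-size i)) ⟩
      β * ζ * (q + threshold q s τ δ)                                   <⟨ βζ[q+threshold]<card q s τ δ ζ β q≥1 τ≥1 δ≥1 (≤-trans α≥1 α≤ζ) (≤-trans (s≤s z≤n) β≥2) ⟩
      2 * q * ζ * β * cardinalityFactor q s τ δ * τ                     ≡⟨ card ⟨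
      ∣ J ∣                                                             ≡⟨ length-elements J ⟨
      length daisies                                                    ≡⟨ length-filter-split rootInY? daisies ⟩
      length rootedInY + length rootedOutside                           ≤⟨ +-monoˡ-≤ _ rootedInY-≤ ⟩
      length coreVertices * q + length rootedOutside                    ∎)
      where open ≤-Reasoning

    core-neighbour : ∀ {j} → j ∈ˡ rootedOutside → ∃ λ y → y ∈ˡ coreVertices × Adj G (root j) y
    core-neighbour {j} j∈ =
      let j∈daisies , _ = ∈-filter⁻ (∁? rootInY?) {xs = daisies} j∈
          p , η≤ = mixed (DaisyFacts.root∈H (daisy (∈-elements⁻ J j∈daisies)))
          y , y∈ = ∣p∣>0⇒Nonempty (P i p ∩ Nbhd G (root j)) (≤-trans η≥1 η≤)
          y∈part , y∈N = x∈p∩q⁻ (P i p) (Nbhd G (root j)) y∈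
      in y , ∈-unionList⁺ (P i) (∈-bigU⁺ (P i) p y∈part) , ∈-Nbhd⁻ G y∈N

    private
      hub-pigeon = pigeonhole (λ j y → Adj? G (root j) y) (threshold q s τ δ) coreVertices rootedOutside
                              core-neighbour rootedOutside-big

    y : V
    y = proj₁ hub-pigeon

    y∈Y : y ∈ Y
    y∈Y = ∈-unionList⁻ (P i) (proj₁ (proj₂ hub-pigeon))

    spokes : List (Fin n)
    spokes = filter (λ j → Adj? G (root j) y) rootedOutside

    spokes-unique : Unique spokes
    spokes-unique = Unique.filter⁺ _ (Unique.filter⁺ (∁? rootInY?) daisies-unique)

    module _ {j} (j∈ : j ∈ˡ spokes) where
      private
        j∈outside = proj₁ (∈-filter⁻ (λ j → Adj? G (root j) y) {xs = rootedOutside} j∈)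

      spoke∈daisies : j ∈ˡ daisies
      spoke∈daisies = proj₁ (∈-filter⁻ (∁? rootInY?) {xs = daisies} j∈outside)

      spoke∈J : j ∈ J
      spoke∈J = ∈-elements⁻ J spoke∈daisies

      spoke-root∈Z : root j ∈ Z
      spoke-root∈Z = x∈p∧x∉q⇒x∈p─q (DaisyFacts.root∈H (daisy spoke∈J)) (proj₂ (∈-filter⁻ (∁? rootInY?) {xs = daisies} j∈outside))

      spoke-root~y : Adj G (root j) y
      spoke-root~y = proj₂ (∈-filter⁻ (λ j → Adj? G (root j) y) {xs = rootedOutside} j∈)

    leafBudget : ℕ
    leafBudget = δ * δ * (q + s) + (1 + 2 * q) * δ

    free : List (Fin n)
    free = filter (∁? (blocks? y)) spokes

    free⊆spokes : ∀ {j} → j ∈ˡ free → j ∈ˡ spokes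
    free⊆spokes = proj₁ ∘ ∈-filter⁻ (∁? (blocks? y)) {xs = spokes}

    free-unblocked : ∀ {j} → j ∈ˡ free → ¬ Blocks y j
    free-unblocked = proj₂ ∘ ∈-filter⁻ (∁? (blocks? y)) {xs = spokes}

    free-big : τ * δ * (q + s) + leafBudget ≤ length free
    free-big = +-cancelˡ-≤ (q + s) _ _ (<⇒≤ (<-≤-trans (proj₂ (proj₂ hub-pigeon))
      (discard-blocked (blocked-≤ (inj₁ (core⊆H y∈Y))) spokes-unique spoke∈daisies)))

    open Blockers (greedy-blockers root (≤-trans q≥1 (m≤m+n q s)) root-sparse root-blocks (τ * δ) leafBudget
                                   (Unique.filter⁺ _ spokes-unique) (spoke∈daisies ∘ free⊆spokes) free-big)

    module _ {z} (z∈ : z ∈ˡ centres) where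
      private
        spoke = ∈-map⁻ root (centres⊆roots z∈)
        z≡root = proj₂ (proj₂ spoke)
        j∈spokes = free⊆spokes (proj₁ (proj₂ spoke))

      centre∈Z : z ∈ Z
      centre∈Z = subst (_∈ Z) (sym z≡root) (spoke-root∈Z j∈spokes)

      centre~y : Adj G z y
      centre~y = subst (λ w → Adj G w y) (sym z≡root) (spoke-root~y j∈spokes)

    colour : V → Fin τ
    colour = proj₁ (χ²≤τ y)

    colour-proper : ∀ {x x′} → x ∈ N2 G y → x′ ∈ N2 G y → Adj G x x′ → colour x ≢ colour x′
    colour-proper = proj₂ (χ²≤τ y) _ _

    privates : V → List V
    privates z = elements (Π ∩ Nbhd G z)

    colourClass : V → Fin τ → List V
    colourClass z k = filter (λ x → colour x Fin.≟ k) (privates z)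

    ∈-colourClass⁻ : ∀ {z k x} → x ∈ˡ colourClass z k → (x ∈ Π × Adj G z x) × colour x ≡ k
    ∈-colourClass⁻ {z} {k} x∈ =
      let x∈privates , colour≡ = ∈-filter⁻ (λ x → colour x Fin.≟ k) {xs = privates z} x∈
          x∈Π , x∈N = x∈p∩q⁻ Π (Nbhd G z) (∈-elements⁻ _ x∈privates)
      in (x∈Π , ∈-Nbhd⁻ G x∈N) , colour≡

    Rich : V → Fin τ → Set
    Rich z k = δ ≤ length (colourClass z k)

    rich? : ∀ z k → Dec (Rich z k)
    rich? z k = δ ≤? length (colourClass z k)

    private instance
      τ-nonZero = >-nonZero τ≥1
      δ-nonZero = >-nonZero δ≥1

    pred[δ]<⇒δ≤ : ∀ {m} → pred δ < m → δ ≤ m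
    pred[δ]<⇒δ≤ {m} = subst (_≤ m) (suc-pred δ)

    τ·pred[δ]<τ·δ : length (allFin τ) * pred δ < τ * δ
    τ·pred[δ]<τ·δ = subst (λ m → m * pred δ < τ * δ) (sym (length-tabulate {n = τ} id)) (*-monoʳ-< τ (m≤pred[n]⇒suc[m]≤n ≤-refl))

    rich-colour : ∀ {z} → z ∈ Z𝒯 → ∃ λ k → k ∈ˡ allFin τ × Rich z k
    rich-colour {z} z∈ =
      let k , k∈ , pred[δ]<class = pigeonhole (λ x k → colour x Fin.≟ k) (pred δ) (allFin τ) (privates z)
                                              (λ {x} _ → colour x , ∈-allFin (colour x) , refl) bound
      in k , k∈ , pred[δ]<⇒δ≤ pred[δ]<class
      where
      bound : length (allFin τ) * pred δ < length (privates z)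
      bound = <-≤-trans τ·pred[δ]<τ·δ (≤-reflexive (sym (trans (length-elements (Π ∩ Nbhd G z)) (trans (∣Π∩N∣ z∈) (*-comm δ τ)))))

    private
      colour-pigeon = pigeonhole rich? (pred δ) (allFin τ) centres (λ z∈ → rich-colour (Z⊆Z𝒯 (centre∈Z z∈)))
                                 (<-≤-trans τ·pred[δ]<τ·δ (≤-reflexive (sym length-centres)))

    col : Fin τ
    col = proj₁ colour-pigeon

    richCentres : List V
    richCentres = filter (λ z → rich? z col) centres

    δ≤richCentres : δ ≤ length richCentres
    δ≤richCentres = pred[δ]<⇒δ≤ (proj₂ (proj₂ colour-pigeon))

    c₁ : Fin δ → V
    c₁ = enumerate richCentres δ≤richCentres

    c₁∈centres : ∀ a → c₁ a ∈ˡ centres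
    c₁∈centres a = proj₁ (∈-filter⁻ (λ z → rich? z col) {xs = centres} (enumerate-∈ richCentres δ≤richCentres a))

    c₁-rich : ∀ a → Rich (c₁ a) col
    c₁-rich a = proj₂ (∈-filter⁻ (λ z → rich? z col) {xs = centres} (enumerate-∈ richCentres δ≤richCentres a))

    ℓ₁ : Fin δ → Fin δ → V
    ℓ₁ a = enumerate (colourClass (c₁ a) col) (c₁-rich a)

    ℓ₁∈Π : ∀ a k → ℓ₁ a k ∈ Π
    ℓ₁∈Π a k = proj₁ (proj₁ (∈-colourClass⁻ (enumerate-∈ _ (c₁-rich a) k)))

    c₁~ℓ₁ : ∀ a k → Adj G (c₁ a) (ℓ₁ a k)
    c₁~ℓ₁ a k = proj₂ (proj₁ (∈-colourClass⁻ (enumerate-∈ _ (c₁-rich a) k)))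

    ℓ₁-colour : ∀ a k → colour (ℓ₁ a k) ≡ col
    ℓ₁-colour a k = proj₂ (∈-colourClass⁻ (enumerate-∈ _ (c₁-rich a) k))

    ℓ₁∈B : ∀ a k → ℓ₁ a k ∈ B i
    ℓ₁∈B a k = Π-neighbour-of-Z∈B (centre∈Z (c₁∈centres a)) (ℓ₁∈Π a k) (c₁~ℓ₁ a k)

    leaves : List V
    leaves = concat (List.tabulate (λ a → List.tabulate (ℓ₁ a)))

    ℓ₁∈leaves : ∀ a k → ℓ₁ a k ∈ˡ leaves
    ℓ₁∈leaves a k = ∈-concat⁺′ (∈-tabulate⁺ k) (∈-tabulate⁺ a)

    leaf∈B : ∀ {x} → x ∈ˡ leaves → x ∈ B i
    leaf∈B {x} x∈ =
      let xs , x∈xs , xs∈ = ∈-concat⁻′ (List.tabulate (λ a → List.tabulate (ℓ₁ a))) x∈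
          a , xs≡ = ∈-tabulate⁻ xs∈
          k , x≡ = ∈-tabulate⁻ (subst (x ∈ˡ_) xs≡ x∈xs)
      in subst (_∈ B i) (sym x≡) (ℓ₁∈B a k)

    remaining : List (Fin n)
    remaining = filter (unblocked? leaves) survivors

    remaining⊆survivors : ∀ {j} → j ∈ˡ remaining → j ∈ˡ survivors
    remaining⊆survivors = proj₁ ∘ ∈-filter⁻ (unblocked? leaves) {xs = survivors}

    remaining-unblocked : ∀ {j} → j ∈ˡ remaining → Unblocked leaves j
    remaining-unblocked = proj₂ ∘ ∈-filter⁻ (unblocked? leaves) {xs = survivors}

    remaining-unique : Unique remaining
    remaining-unique = Unique.filter⁺ (unblocked? leaves) survivors-unique

    survivor∈spokes : ∀ {j} → j ∈ˡ survivors → j ∈ˡ spokes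
    survivor∈spokes = free⊆spokes ∘ survivors⊆

    remaining-big : (1 + 2 * q) * δ ≤ length remaining
    remaining-big = +-cancelˡ-≤ (δ * δ * (q + s)) _ _ (begin
      leafBudget                                            ≤⟨ length-survivors ⟩
      length survivors                                      ≤⟨ remove-blocked leaves (All.tabulate (λ x∈ → blocked-≤ (inj₂ (leaf∈B x∈))))
                                                                 survivors-unique (spoke∈daisies ∘ survivor∈spokes) ⟩
      length leaves * (q + s) + length remaining            ≡⟨ cong (λ m → m * (q + s) + length remaining)
                                                                 (length-concat-tabulate _ δ (λ a → length-tabulate (ℓ₁ a))) ⟩
      δ * δ * (q + s) + length remaining                    ∎)
      where open ≤-Reasoning

    rootSeesEye? : ∀ j j′ → Dec (Adj G (root j) (eye j′))
    rootSeesEye? j j′ = Adj? G (root j) (eye j′)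

    -- A root sees no petal of another daisy, so every eye it sees belongs to a daisy it is good for.
    remaining-outdegree : FinLists.OutDegree≤ rootSeesEye? q remaining
    remaining-outdegree {j} j∈ = <⇒≤ (≤-<-trans (FinLists.Unique-length-≤ (Unique.filter⁺ (rootSeesEye? j) remaining-unique) seen⊆good)
                                                (few (root j) (inj₁ (DaisyFacts.root∈H (daisy j∈J)))))
      where
      j∈J = spoke∈J (survivor∈spokes (remaining⊆survivors j∈))
      seen⊆good : ∀ {j′} → j′ ∈ˡ filter (rootSeesEye? j) remaining → j′ ∈ˡ goodFor (root j)
      seen⊆good {j′} j′∈ =
        let j′∈remaining , root~eye′ = ∈-filter⁻ (rootSeesEye? j) {xs = remaining} j′∈
            j′∈daisies = spoke∈daisies (survivor∈spokes (remaining⊆survivors j′∈remaining))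
        in ∈-filter⁺ (good? (root j)) j′∈daisies (root~eye′ , root≁pet-of j∈J (∈-elements⁻ J j′∈daisies))

    private
      selection = FinLists.independent-subset rootSeesEye? q δ remaining remaining-unique remaining-outdegree remaining-big

    open FinLists.IndependentSubset selection
      renaming (members to selected; length-members to length-selected; members-unique to selected-unique;
                members⊆ to selected⊆remaining; independent to selected-independent)

    δ≤selected : δ ≤ length selected
    δ≤selected = ≤-reflexive (sym length-selected)

    d : Fin δ → Fin n
    d = enumerate selected δ≤selected

    d-injective : ∀ a b → d a ≡ d b → a ≡ b
    d-injective = enumerate-injective δ≤selected selected-unique

    d∈remaining : ∀ a → d a ∈ˡ remaining
    d∈remaining a = selected⊆remaining (enumerate-∈ selected δ≤selected a)

    d-independent : ∀ a b → a ≢ b → ¬ Adj G (root (d a)) (eye (d b))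
    d-independent a b a≢b = selected-independent
      (enumerate-∈ selected δ≤selected a) (enumerate-∈ selected δ≤selected b) (a≢b ∘ d-injective a b)

    d∈survivors : ∀ a → d a ∈ˡ survivors
    d∈survivors = remaining⊆survivors ∘ d∈remaining

    d∈spokes : ∀ a → d a ∈ˡ spokes
    d∈spokes = survivor∈spokes ∘ d∈survivors

    d∈J : ∀ a → d a ∈ J
    d∈J = spoke∈J ∘ d∈spokes

    module D (a : Fin δ) = DaisyFacts (daisy (d∈J a))

    m₂ c₂ : Fin δ → V
    m₂ a = root (d a)
    c₂ a = eye (d a)

    δ≤pet : ∀ a → δ ≤ length (elements (pet (d a)))
    δ≤pet a = ≤-reflexive (sym (trans (length-elements (pet (d a))) (D.∣pet∣ a)))

    ℓ₂ : Fin δ → Fin δ → V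
    ℓ₂ a = enumerate (elements (pet (d a))) (δ≤pet a)

    ℓ₂∈pet : ∀ a k → ℓ₂ a k ∈ pet (d a)
    ℓ₂∈pet a k = ∈-elements⁻ (pet (d a)) (enumerate-∈ _ (δ≤pet a) k)

    c₁∈Z : ∀ a → c₁ a ∈ Z
    c₁∈Z a = centre∈Z (c₁∈centres a)

    m₂∈Z : ∀ a → m₂ a ∈ Z
    m₂∈Z a = spoke-root∈Z (d∈spokes a)

    Z⊆H𝒯 : ∀ {z} → z ∈ Z → z ∈ H𝒯
    Z⊆H𝒯 z∈Z = ∈-bigU⁺ H i (p─q⊆p (H i) Y z∈Z)

    y∈H𝒯 : y ∈ H𝒯
    y∈H𝒯 = ∈-bigU⁺ H i (core⊆H y∈Y)

    Z∌y : ∀ {z} → z ∈ Z → y ≢ z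
    Z∌y z∈Z = x∈p∧y∉p⇒x≢y y∈Y (x∈p─q⇒x∉q (H i) Y z∈Z)

    ℓ₁∉H𝒯 : ∀ a k → ℓ₁ a k ∉ H𝒯
    ℓ₁∉H𝒯 a k = U∉H𝒯 (Π⊆U (ℓ₁∈Π a k))

    centre-unblocked : ∀ a b → ¬ Blocks (c₁ a) (d b)
    centre-unblocked a b = All.lookup (survivors-unblocked (d∈survivors b)) (c₁∈centres a)

    leaf-unblocked : ∀ a k b → ¬ Blocks (ℓ₁ a k) (d b)
    leaf-unblocked a k b = All.lookup (remaining-unblocked (d∈remaining b)) (ℓ₁∈leaves a k)

    c₁≢m₂ : ∀ a b → c₁ a ≢ m₂ b
    c₁≢m₂ a b c₁≡m₂ = centre-unblocked a b (subst (λ w → Blocks w (d b)) (sym c₁≡m₂) (inj₁ (D.root~eye b)))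

    Z𝒯-neighbour-of-ℓ₁ : ∀ {a k z} → z ∈ Z → Adj G z (ℓ₁ a k) → z ≡ c₁ a
    Z𝒯-neighbour-of-ℓ₁ {a} {k} z∈Z z~ℓ = unique-Z𝒯-neighbour (ℓ₁∈Π a k) (Z⊆Z𝒯 z∈Z) (Adj-sym G z~ℓ)
                                                         (Z⊆Z𝒯 (c₁∈Z a)) (Adj-sym G (c₁~ℓ₁ a k))

    c₁-injective : ∀ a b → c₁ a ≡ c₁ b → a ≡ b
    c₁-injective = enumerate-injective δ≤richCentres (Unique.filter⁺ (λ z → rich? z col) centres-unique)

    ℓ₁-injective : ∀ a k b k′ → ℓ₁ a k ≡ ℓ₁ b k′ → a ≡ b × k ≡ k′
    ℓ₁-injective a k b k′ ℓ≡ℓ′ = a≡b , enumerate-injective (c₁-rich a) class-unique k k′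
                                         (subst (λ b → ℓ₁ a k ≡ ℓ₁ b k′) (sym a≡b) ℓ≡ℓ′)
      where
      class-unique = Unique.filter⁺ (λ x → colour x Fin.≟ col) (elements-unique (Π ∩ Nbhd G (c₁ a)))
      a≡b = c₁-injective a b (Z𝒯-neighbour-of-ℓ₁ (c₁∈Z a) (subst (Adj G (c₁ a)) ℓ≡ℓ′ (c₁~ℓ₁ a k)))

    ℓ₁∈N²[y] : ∀ a k → ℓ₁ a k ∈ N2 G y
    ℓ₁∈N²[y] a k = ∈-N2 G (Adj-sym G (centre~y (c₁∈centres a))) (c₁~ℓ₁ a k)

    m₂-injective : ∀ a b → m₂ a ≡ m₂ b → a ≡ b
    m₂-injective a b m₂≡ = by-cases a b id
      (λ a≢b → contradiction (subst (λ w → Adj G w (c₂ b)) (sym m₂≡) (D.root~eye b)) (d-independent a b a≢b))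

    module _ (a b : Fin δ) (a≢b : a ≢ b) where
      private
        d≢ = a≢b ∘ d-injective a b
      flowers-disjoint = flower-disjoint (d∈J a) (d∈J b) d≢
      flowers-nonadjacent = flower-nonadjacent (d∈J a) (d∈J b) d≢
      m₂≁other-ℓ₂ = root≁other-pet (d∈J a) (d∈J b) d≢

    induced-T : HasInducedT G δ
    induced-T = hasInducedT G δ record
      { h = y ; c₁ = c₁ ; m₂ = m₂ ; c₂ = c₂ ; ℓ₁ = ℓ₁ ; ℓ₂ = ℓ₂
      ; h~c₁ = λ a → Adj-sym G (centre~y (c₁∈centres a))
      ; c₁~ℓ₁ = c₁~ℓ₁
      ; h~m₂ = λ a → Adj-sym G (spoke-root~y (d∈spokes a))
      ; m₂~c₂ = D.root~eye
      ; c₂~ℓ₂ = λ a k → D.eye~pet a (ℓ₂∈pet a k)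
      ; h≁ℓ₁ = λ a k y~ℓ → Π≁Y𝒯 (ℓ₁∈Π a k) (∈-bigU⁺ (Yi G α β P H U) i y∈Y) (Adj-sym G y~ℓ)
      ; h≁c₂ = λ a y~c₂ → free-unblocked (survivors⊆ (d∈survivors a)) (inj₁ y~c₂)
      ; h≁ℓ₂ = λ a k y~ℓ → free-unblocked (survivors⊆ (d∈survivors a)) (inj₂ (_ , ℓ₂∈pet a k , y~ℓ))
      ; c₁≁c₁ = λ a b → Z-stable _ _ (c₁∈Z a) (c₁∈Z b)
      ; c₁≁ℓ₁ = λ a b k a≢b c₁~ℓ → a≢b (c₁-injective a b (Z𝒯-neighbour-of-ℓ₁ (c₁∈Z a) c₁~ℓ))
      ; c₁≁m₂ = λ a b → Z-stable _ _ (c₁∈Z a) (m₂∈Z b)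
      ; c₁≁c₂ = λ a b c₁~c₂ → centre-unblocked a b (inj₁ c₁~c₂)
      ; c₁≁ℓ₂ = λ a b k c₁~ℓ → centre-unblocked a b (inj₂ (_ , ℓ₂∈pet b k , c₁~ℓ))
      ; ℓ₁≁ℓ₁ = λ a k b k′ ℓ~ℓ → colour-proper (ℓ₁∈N²[y] a k) (ℓ₁∈N²[y] b k′) ℓ~ℓ (trans (ℓ₁-colour a k) (sym (ℓ₁-colour b k′)))
      ; ℓ₁≁m₂ = λ a k b ℓ~m₂ → c₁≢m₂ a b (sym (Z𝒯-neighbour-of-ℓ₁ (m₂∈Z b) (Adj-sym G ℓ~m₂)))
      ; ℓ₁≁c₂ = λ a k b ℓ~c₂ → leaf-unblocked a k b (inj₁ ℓ~c₂)
      ; ℓ₁≁ℓ₂ = λ a k b k′ ℓ~ℓ → leaf-unblocked a k b (inj₂ (_ , ℓ₂∈pet b k′ , ℓ~ℓ))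
      ; m₂≁m₂ = λ a b → Z-stable _ _ (m₂∈Z a) (m₂∈Z b)
      ; m₂≁c₂ = d-independent
      ; m₂≁ℓ₂ = λ a b k → by-cases a b (λ { refl → D.root≁pet a (ℓ₂∈pet a k) }) (λ a≢b → m₂≁other-ℓ₂ a b a≢b (ℓ₂∈pet b k))
      ; c₂≁c₂ = λ a b → by-cases a b (λ { refl → Adj-irrefl G }) (λ a≢b → flowers-nonadjacent a b a≢b (eye∈flower _) (eye∈flower _))
      ; c₂≁ℓ₂ = λ a b k a≢b → flowers-nonadjacent a b a≢b (eye∈flower _) (pet⊆flower (ℓ₂∈pet b k))
      ; ℓ₂≁ℓ₂ = λ a k b k′ → by-cases a b (λ { refl → D.pet-stable a (ℓ₂∈pet a k) (ℓ₂∈pet a k′) })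
                                        (λ a≢b → flowers-nonadjacent a b a≢b (pet⊆flower (ℓ₂∈pet a k)) (pet⊆flower (ℓ₂∈pet b k′)))
      ; h≢c₁ = λ a → Z∌y (c₁∈Z a)
      ; h≢ℓ₁ = λ a k → x∈p∧y∉p⇒x≢y y∈H𝒯 (ℓ₁∉H𝒯 a k)
      ; h≢m₂ = λ a → Z∌y (m₂∈Z a)
      ; h≢c₂ = λ a → x∈p∧y∉p⇒x≢y y∈H𝒯 (D.eye∉H𝒯 a)
      ; h≢ℓ₂ = λ a k → x∈p∧y∉p⇒x≢y y∈H𝒯 (D.pet∉H𝒯 a (ℓ₂∈pet a k))
      ; c₁-injective = c₁-injective
      ; c₁≢ℓ₁ = λ a b k → x∈p∧y∉p⇒x≢y (Z⊆H𝒯 (c₁∈Z a)) (ℓ₁∉H𝒯 b k)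
      ; c₁≢m₂ = c₁≢m₂
      ; c₁≢c₂ = λ a b → x∈p∧y∉p⇒x≢y (Z⊆H𝒯 (c₁∈Z a)) (D.eye∉H𝒯 b)
      ; c₁≢ℓ₂ = λ a b k → x∈p∧y∉p⇒x≢y (Z⊆H𝒯 (c₁∈Z a)) (D.pet∉H𝒯 b (ℓ₂∈pet b k))
      ; ℓ₁-injective = ℓ₁-injective
      ; ℓ₁≢m₂ = λ a k b → x∈p∧y∉p⇒x≢y (Z⊆H𝒯 (m₂∈Z b)) (ℓ₁∉H𝒯 a k) ∘ sym
      ; ℓ₁≢c₂ = λ a k b → x∈p∧y∉p⇒x≢y (ℓ₁∈Π a k) (D.eye∉Π b)
      ; ℓ₁≢ℓ₂ = λ a k b k′ → x∈p∧y∉p⇒x≢y (ℓ₁∈Π a k) (D.pet∉Π b (ℓ₂∈pet b k′))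
      ; m₂-injective = m₂-injective
      ; m₂≢c₂ = λ a b → x∈p∧y∉p⇒x≢y (Z⊆H𝒯 (m₂∈Z a)) (D.eye∉H𝒯 b)
      ; m₂≢ℓ₂ = λ a b k → x∈p∧y∉p⇒x≢y (Z⊆H𝒯 (m₂∈Z a)) (D.pet∉H𝒯 b (ℓ₂∈pet b k))
      ; c₂-injective = λ a b c₂≡ → by-cases a b id
          (λ a≢b → contradiction (subst (_∈ flower (d b)) (sym c₂≡) (eye∈flower _)) (flowers-disjoint a b a≢b (eye∈flower _)))
      ; c₂≢ℓ₂ = λ a b k c₂≡ → by-cases a b (λ { refl → D.eye∉pet a (subst (_∈ pet (d a)) (sym c₂≡) (ℓ₂∈pet a k)) })
          (λ a≢b → flowers-disjoint a b a≢b (eye∈flower _) (subst (_∈ flower (d b)) (sym c₂≡) (pet⊆flower (ℓ₂∈pet b k))))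
      ; ℓ₂-injective = λ a k b k′ ℓ≡ → by-cases a b
          (λ { refl → refl , enumerate-injective (δ≤pet a) (elements-unique (pet (d a))) k k′ ℓ≡ })
          (λ a≢b → contradiction (subst (_∈ flower (d b)) (sym ℓ≡) (pet⊆flower (ℓ₂∈pet b k′)))
                                 (flowers-disjoint a b a≢b (pet⊆flower (ℓ₂∈pet a k))))
      }

mainTheorem16 :
    (τ α δ β : ℕ) (θ : ℕ → ℕ) → 1 ≤ α → 1 ≤ δ → 2 ≤ β →
    (∀ a b → a ≤ b → θ a ≤ θ b) →
    (η ζ q s : ℕ) → 1 ≤ η → η ≤ ζ → α ≤ ζ →
    (G : Graph) → Conditions G τ α δ β θ →
    (n : ℕ) (P : Fin n → Fin β → Subset (Graph.N G)) (H : Fin n → Subset (Graph.N G))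
    (U : Subset (Graph.N G)) →
    IsTemplateArray G α β P H U ζ η → TwoCleaned G α β P H U →
    (Π : Subset (Graph.N G)) → IsPrivatization G α β P H U δ τ Π →
    (B : Fin n → Subset (Graph.N G)) → IsShadowing G α β P H U B →
    ShadowDegreeLe G α β P H U B (U ─ Π) s →
    (i : Fin n) (J : Subset n) (root eye : Fin n → Fin (Graph.N G))
    (pet : Fin n → Subset (Graph.N G)) →
    IsBunch G α β P H U δ B i J root eye pet →
    (∀ j → j ∈ J → root j ∉ Π × eye j ∉ Π × (∀ p → p ∈ pet j → p ∉ Π)) →
    ∣ J ∣ ≡ 2 * q * ζ * β * (1 + (q + s) * (δ * δ + 1) + 2 * δ + δ * τ) * τ →
    Σ (Fin (Graph.N G)) λ u → (u ∈ H i ⊎ u ∈ B i) ×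
      Σ (Subset n) λ J' → J' ⊆ J × ∣ J' ∣ ≡ q ×
        (∀ j → j ∈ J' → Adj G u (eye j) × (∀ p → p ∈ pet j → ¬ Adj G u p))
mainTheorem16 τ α δ β _ α≥1 δ≥1 β≥2 _ η ζ q s η≥1 _ α≤ζ G (no-T , χ²≤τ , _) n P H U
              array cleaned Π privatization B shadowing degree i J root eye pet bunch avoidsΠ card =
  [ id , (λ few → contradiction (FromFewGood.induced-T few) no-T) ]′ dichotomy
  where
  open Bunch τ α δ β α≥1 δ≥1 β≥2 η ζ q s η≥1 α≤ζ G χ²≤τ n P H U array cleaned Π privatization B shadowing degree
             i J root eye pet bunch avoidsΠ card
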